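{- Let $\mathbb{F}$ be a finite field, $d\ge1$, $n_1,\dots,n_d$ positive integers and $\delta>0$. Let $\mathcal B'\subset \mathcal B$ be a multiset such that $|\mathcal B'|\geq \delta |\mathcal B|$. Then there exists an $f_1$-system whose elements all lie in $f_2\mathcal B'-f_2\mathcal B'$, where $f_1=\frac{16^{d}}{\delta^2}$ and $f_2=4^d$.
   Context: $\mathcal B$ is the multiset $\{u_1\otimes\dots\otimes u_d:u_i\in\mathbb{F}^{n_i}\}\subset\mathbb{F}^{n_1}\otimes\dots\otimes\mathbb{F}^{n_d}$ (one element per tuple), and $\mathcal B'$ is a submultiset. $kB-kB$ denotes the set of elements obtainable by adding at most $k$ and subtracting at most $k$ members of $B$. An $l$-system: given a subspace $U\subset\mathbb{F}^{n_1}$ of codimension at most $l$, and for every $2\le k\le d$ and every $u_1\in U,u_2\in U_{u_1},\dots,u_{k-1}\in U_{u_1,\dots,u_{k-2}}$ a subspace $U_{u_1,\dots,u_{k-1}}\subset\mathbb{F}^{n_k}$ of codimension at most $l$, the multiset $\{u_1\otimes\dots\otimes u_d: u_1\in U,\dots,u_d\in U_{u_1,\dots,u_{d-1}}\}$ is an $l$-system. -}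

module Defs where

open import Data.Nat as ℕ using (ℕ; zero; suc)
open import Data.Fin using (Fin; zero; suc)
open import Data.Fin.Properties using (_≟_)
open import Data.Vec as Vec using (Vec; []; _∷_)
open import Data.List as List using (List; []; _∷_; length; filter; cartesianProductWith; allFin)
open import Data.List.Relation.Unary.All using (All)
open import Data.Bool using (Bool; true; false; T)
open import Data.Product using (Σ; _×_; _,_; ∃; ∃-syntax)
open import Data.Unit using (⊤; tt)
open import Data.Integer using (+_)
open import Data.Rational as ℚ using (ℚ; 0ℚ; _÷_; Positive; positive)
open import Data.Rational.Properties using (pos⇒nonZero; pos*pos⇒pos)
open import Relation.Binary.PropositionalEquality using (_≡_; _≢_)
open import Relation.Nullary using (¬_)
open import Algebra.Structures using (IsCommutativeRing)

-- A finite field, presented (up to isomorphism) on the carrier Fin q,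
-- with propositional equality.

record FiniteField : Set where
  field
    q    : ℕ
    _+_  : Fin q → Fin q → Fin q
    _*_  : Fin q → Fin q → Fin q
    -_   : Fin q → Fin q
    0#   : Fin q
    1#   : Fin q
    isCommutativeRing : IsCommutativeRing _≡_ _+_ _*_ -_ 0# 1#
    0≢1  : 0# ≢ 1#
    inverse : ∀ x → x ≢ 0# → ∃[ y ] (x * y ≡ 1#)


ℕtoℚ : ℕ → ℚ
ℕtoℚ n = + n ℚ./ 1

f₁ : (d : ℕ) (δ : ℚ) → δ ℚ.> 0ℚ → ℚ
f₁ d δ δ>0 =
  let instance pδ : Positive δ
               pδ = positive δ>0
      instance nz : ℚ.NonZero (δ ℚ.* δ)
               nz = pos⇒nonZero (δ ℚ.* δ) {{pos*pos⇒pos δ δ}}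
  in ℕtoℚ (16 ℕ.^ d) ÷ (δ ℚ.* δ)

f₂ : ℕ → ℕ
f₂ d = 4 ℕ.^ d

module _ (F : FiniteField) where
  open FiniteField F

  Scalar : Set
  Scalar = Fin q

  Vector : ℕ → Set
  Vector n = Vec Scalar n

  allVectors : (n : ℕ) → List (Vector n)
  allVectors zero    = [] ∷ []
  allVectors (suc n) = cartesianProductWith _∷_ (allFin q) (allVectors n)

  -- tuples (u₁,…,u_d) with uᵢ ∈ F^{nᵢ}; the dimension list is ns = [n₁,…,n_d]
  Tuple : List ℕ → Set
  Tuple []       = ⊤
  Tuple (n ∷ ns) = Vector n × Tuple ns

  allTuples : (ns : List ℕ) → List (Tuple ns)
  allTuples []       = tt ∷ []
  allTuples (n ∷ ns) = cartesianProductWith _,_ (allVectors n) (allTuples ns)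

  Index : List ℕ → Set
  Index []       = ⊤
  Index (n ∷ ns) = Fin n × Index ns

  -- elements of F^{n₁} ⊗ … ⊗ F^{n_d}, as d-dimensional arrays
  Tensor : List ℕ → Set
  Tensor ns = Index ns → Scalar

  tensor : {ns : List ℕ} → Tuple ns → Tensor ns
  tensor {[]}     tt       tt       = 1#
  tensor {n ∷ ns} (u , us) (i , is) = Vec.lookup u i * tensor us is

  zeroT : {ns : List ℕ} → Tensor ns
  zeroT _ = 0#

  _+T_ : {ns : List ℕ} → Tensor ns → Tensor ns → Tensor ns
  (s +T t) is = s is + t is

  _-T_ : {ns : List ℕ} → Tensor ns → Tensor ns → Tensor ns
  (s -T t) is = s is + (- t is)

  sumT : {ns : List ℕ} → List (Tuple ns) → Tensor ns
  sumT []       = zeroT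
  sumT (x ∷ xs) = tensor x +T sumT xs

  -- A submultiset 𝓑' of 𝓑 (𝓑 has one element per tuple) is a choice,
  -- for each tuple, of whether its element belongs to 𝓑'.
  SubMultiset : List ℕ → Set
  SubMultiset ns = Tuple ns → Bool

  size𝓑 : List ℕ → ℕ
  size𝓑 ns = length (allTuples ns)

  size𝓑' : (ns : List ℕ) → SubMultiset ns → ℕ
  size𝓑' ns B' = length (filter (λ x → T? (B' x)) (allTuples ns))
    where
      open import Relation.Nullary.Decidable using (Dec; yes; no)
      T? : (b : Bool) → Dec (T b)
      T? true  = yes tt
      T? false = no (λ ())

  -- t ∈ k𝓑' − k𝓑' : t is a sum of at most k members of 𝓑'
  -- minus a sum of at most k members of 𝓑'.
  InSumDiff : (ns : List ℕ) → SubMultiset ns → ℕ → Tensor ns → Set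
  InSumDiff ns B' k t =
    Σ (List (Tuple ns)) λ xs → Σ (List (Tuple ns)) λ ys →
      All (λ x → T (B' x)) xs × All (λ y → T (B' y)) ys ×
      length xs ℕ.≤ k × length ys ℕ.≤ k ×
      (∀ is → t is ≡ (sumT xs -T sumT ys) is)

  dot : {n : ℕ} → Vector n → Vector n → Scalar
  dot []       []       = 0#
  dot (a ∷ as) (b ∷ bs) = (a * b) + dot as bs

  -- A subspace of F^n of codimension at most l, presented as the common
  -- kernel of m ≤ l linear functionals (the rows of A).
  record Subspace (l : ℚ) (n : ℕ) : Set where
    constructor subspace
    field
      m     : ℕ
      m≤l   : ℕtoℚ m ℚ.≤ l
      rows  : Vec (Vector n) m

  _∈S_ : {l : ℚ} {n : ℕ} → Vector n → Subspace l n → Set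
  u ∈S S = Vec.foldr (λ _ → Set) (λ row P → (dot row u ≡ 0#) × P) ⊤ (Subspace.rows S)

  -- The data of an l-system: U ⊂ F^{n₁}, and for every u₁ ∈ U a subspace
  -- U_{u₁} ⊂ F^{n₂}, for every u₂ ∈ U_{u₁} a subspace U_{u₁,u₂} ⊂ F^{n₃}, etc.,
  -- each of codimension at most l.
  System : ℚ → List ℕ → Set
  System l []       = ⊤
  System l (n ∷ ns) = Σ (Subspace l n) λ U → (u : Vector n) → u ∈S U → System l ns

  -- the tuples (u₁,…,u_d) with u₁ ∈ U, u₂ ∈ U_{u₁}, …, u_d ∈ U_{u₁,…,u_{d-1}};
  -- the l-system is the multiset of the tensors of these tuples.
  InSystem : {l : ℚ} {ns : List ℕ} → System l ns → Tuple ns → Set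
  InSystem {ns = []}     tt       tt       = ⊤
  InSystem {ns = n ∷ ns} (U , rest) (u , us) = Σ (u ∈S U) λ p → InSystem (rest u p) us

{-# OPTIONS --safe #-}
-- Call x ∈ F^{n₁} dense if its fibre {w : (x , w) ∈ 𝓑'} has density at
-- least δ/2; by Markov's inequality the dense x form a set A of density α ≥ δ/2.  A Bogolyubov-type
-- lemma gives at most 2/α² ≤ 8/δ² functionals whose common kernel consists of vectors
-- u = x₁ + x₂ − x₃ − x₄ with xᵢ ∈ A.  For such u, intersecting the four (δ/2)-systems given by
-- induction for the fibres of the xᵢ costs 4 · 16^(d-1) / (δ/2)² = 16^d / δ², and
-- u ⊗ w = x₁ ⊗ w + x₂ ⊗ w − x₃ ⊗ w − x₄ ⊗ w lies in 4^d 𝓑' − 4^d 𝓑'.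
--
-- The Bogolyubov lemma is Fourier analysis phrased as counting over one vector ξ on each line.  The bias
-- of A along ξ, q · #{(x , y) ∈ A² : ξ·x = ξ·y} − |A|², is the Fourier mass of A on the nonzero multiples
-- of ξ; the biases add up to N|A| − |A|² (N = qⁿ), so at most 2N²/|A|² of them exceed |A|³/(2N), and
-- those ξ form the spectrum.  If u ⊥ spectrum had no representation, the centred counts of quadruples
-- in A⁴ with ξ·(x₁ + x₂ − x₃ − x₄) = ξ·u would add up to −|A|⁴ over all lines, while by Cauchy–Schwarz
-- each is at least −bias², and at least 0 when ξ·u = 0.  So 2N · (centred count) + |A|³ · bias is
-- nonnegative on every line, yet its total is −N|A|⁴ − |A|⁵.
module Submission where

open import Defs
open import Level using (0ℓ)
open import Data.Nat as ℕ using (ℕ; zero; suc; _^_)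
import Data.Nat.Properties as ℕP
open import Data.Integer as ℤ using (ℤ; +_; 0ℤ; 1ℤ)
import Data.Integer.Properties as ℤP
open import Data.Integer.Tactic.RingSolver using (solve-∀)
open import Data.Rational as ℚ using (ℚ; mkℚ; 0ℚ; ↥_; ↧_; ↧ₙ_; toℚᵘ)
import Data.Rational.Properties as ℚP
import Data.Rational.Unnormalised as ℚᵘ
import Data.Rational.Unnormalised.Properties as ℚᵘP
import Data.Nat.Coprimality as Coprime
open import Data.Fin.Properties using (_≟_; nonZeroIndex)
open import Data.Vec as Vec using (Vec; []; _∷_; zipWith)
import Data.Vec.Properties as VecP
open import Data.List using (List; []; _∷_; length; map; _++_; cartesianProductWith; cartesianProduct; filter; allFin)
import Data.List.Properties as ListP
open import Data.List.Membership.Propositional using (_∈_; find; lose)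
open import Data.List.Membership.Propositional.Properties
  using (∈-allFin; ∈-filter⁺; ∈-filter⁻; ∈-cartesianProduct⁻)
open import Data.List.Relation.Unary.All as All using (All; []; _∷_)
import Data.List.Relation.Unary.All.Properties as AllP
open import Data.List.Relation.Unary.AllPairs using ([]; _∷_)
open import Data.List.Relation.Unary.Any using (here; there; any?)
open import Data.List.Relation.Unary.Unique.Propositional using (Unique)
open import Data.List.Relation.Unary.Unique.Propositional.Properties using (allFin⁺; cartesianProductWith⁺; filter⁺)
open import Data.Bool using (T; true; false)
open import Data.Product using (Σ; _×_; _,_; proj₁; proj₂; ∃-syntax)
open import Data.Sum using (_⊎_; inj₁; inj₂)
open import Data.Unit using (⊤; tt)
open import Data.Empty using (⊥; ⊥-elim)
open import Data.Maybe using (nothing)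
open import Relation.Nullary using (¬_; Dec; yes; no)
open import Relation.Unary using (Decidable)
open import Relation.Binary.Definitions using (DecidableEquality)
open import Relation.Binary.PropositionalEquality
open import Function using (_∘_; _⇔_; mk⇔; Equivalence)
open import Algebra.Bundles using (CommutativeRing)
open import Tactic.RingSolver.Core.AlmostCommutativeRing using (fromCommutativeRing)

module Sums where

  open import Data.Integer using (_+_; _*_; _≤_)

  ∑ : {A : Set} → List A → (A → ℤ) → ℤ
  ∑ []       f = 0ℤ
  ∑ (x ∷ xs) f = f x + ∑ xs f

  ⟦_⟧ : {P : Set} → Dec P → ℤ
  ⟦ yes _ ⟧ = 1ℤ
  ⟦ no _ ⟧  = 0ℤ

  module _ {P : Set} where

    ⟦⟧-yes : (d : Dec P) → P → ⟦ d ⟧ ≡ 1ℤ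
    ⟦⟧-yes (yes _) _ = refl
    ⟦⟧-yes (no ¬p) p = ⊥-elim (¬p p)

    ⟦⟧-no : (d : Dec P) → ¬ P → ⟦ d ⟧ ≡ 0ℤ
    ⟦⟧-no (yes p) ¬p = ⊥-elim (¬p p)
    ⟦⟧-no (no _)  _  = refl

    ⟦⟧-⇔ : {Q : Set} (d : Dec P) (e : Dec Q) → (P → Q) → (Q → P) → ⟦ d ⟧ ≡ ⟦ e ⟧
    ⟦⟧-⇔ (yes _) (yes _) _ _ = refl
    ⟦⟧-⇔ (yes p) (no ¬q) f _ = ⊥-elim (¬q (f p))
    ⟦⟧-⇔ (no ¬p) (yes q) _ g = ⊥-elim (¬p (g q))
    ⟦⟧-⇔ (no _)  (no _)  _ _ = refl

  module _ {A : Set} where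

    ∑-cong : (xs : List A) {f g : A → ℤ} → (∀ x → f x ≡ g x) → ∑ xs f ≡ ∑ xs g
    ∑-cong []       _ = refl
    ∑-cong (x ∷ xs) e = cong₂ _+_ (e x) (∑-cong xs e)

    ∑-cong-∈ : (xs : List A) {f g : A → ℤ} → (∀ {x} → x ∈ xs → f x ≡ g x) → ∑ xs f ≡ ∑ xs g
    ∑-cong-∈ []       _ = refl
    ∑-cong-∈ (x ∷ xs) e = cong₂ _+_ (e (here refl)) (∑-cong-∈ xs (e ∘ there))

    ∑-zero : (xs : List A) → ∑ xs (λ _ → 0ℤ) ≡ 0ℤ
    ∑-zero []       = refl
    ∑-zero (_ ∷ xs) = trans (ℤP.+-identityˡ _) (∑-zero xs)

    ∑-+ : (xs : List A) (f g : A → ℤ) → ∑ xs (λ x → f x + g x) ≡ ∑ xs f + ∑ xs g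
    ∑-+ []       f g = refl
    ∑-+ (x ∷ xs) f g = trans (cong (_+_ (f x + g x)) (∑-+ xs f g)) (interchange (f x) (g x) (∑ xs f) (∑ xs g))
      where interchange : ∀ a b c d → (a + b) + (c + d) ≡ (a + c) + (b + d)
            interchange = solve-∀

    ∑-*ˡ : (xs : List A) (c : ℤ) (f : A → ℤ) → ∑ xs (λ x → c * f x) ≡ c * ∑ xs f
    ∑-*ˡ []       c f = sym (ℤP.*-zeroʳ c)
    ∑-*ˡ (x ∷ xs) c f = trans (cong (_+_ (c * f x)) (∑-*ˡ xs c f)) (sym (ℤP.*-distribˡ-+ c (f x) (∑ xs f)))

    ∑-const : (xs : List A) (c : ℤ) → ∑ xs (λ _ → c) ≡ + length xs * c
    ∑-const []       c = sym (ℤP.*-zeroˡ c)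
    ∑-const (x ∷ xs) c = begin
      c + ∑ xs (λ _ → c)       ≡⟨ cong (_+_ c) (∑-const xs c) ⟩
      c + + length xs * c      ≡⟨ cong (_+ + length xs * c) (sym (ℤP.*-identityˡ c)) ⟩
      1ℤ * c + + length xs * c ≡⟨ sym (ℤP.*-distribʳ-+ c 1ℤ (+ length xs)) ⟩
      + ℕ.suc (length xs) * c  ∎
      where open ≡-Reasoning

    ∑-++ : (xs ys : List A) (f : A → ℤ) → ∑ (xs ++ ys) f ≡ ∑ xs f + ∑ ys f
    ∑-++ []       ys f = sym (ℤP.+-identityˡ _)
    ∑-++ (x ∷ xs) ys f = trans (cong (_+_ (f x)) (∑-++ xs ys f)) (sym (ℤP.+-assoc (f x) (∑ xs f) (∑ ys f)))

    ∑-mono-≤ : (xs : List A) {f g : A → ℤ} → (∀ {x} → x ∈ xs → f x ≤ g x) → ∑ xs f ≤ ∑ xs g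
    ∑-mono-≤ []       _ = ℤP.≤-refl
    ∑-mono-≤ (x ∷ xs) h = ℤP.+-mono-≤ (h (here refl)) (∑-mono-≤ xs (h ∘ there))

    ∑-nonNeg : (xs : List A) {f : A → ℤ} → (∀ {x} → x ∈ xs → 0ℤ ≤ f x) → 0ℤ ≤ ∑ xs f
    ∑-nonNeg xs {f} h = subst (_≤ ∑ xs f) (∑-zero xs) (∑-mono-≤ xs h)

    ∑-filter-≤ : {P : A → Set} (P? : Decidable P) (xs : List A) {f : A → ℤ} → (∀ x → 0ℤ ≤ f x) →
                 ∑ (filter P? xs) f ≤ ∑ xs f
    ∑-filter-≤ P? []       _ = ℤP.≤-refl
    ∑-filter-≤ P? (x ∷ xs) {f} f≥0 with P? x
    ... | yes _ = ℤP.+-monoʳ-≤ (f x) (∑-filter-≤ P? xs f≥0)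
    ... | no _  = ℤP.≤-trans (∑-filter-≤ P? xs f≥0) (ℤP.i≤j+i (∑ xs f) (f x) {{ℤ.nonNegative (f≥0 x)}})

    ∑-indicator : {P : A → Set} (P? : Decidable P) (xs : List A) → ∑ xs (λ x → ⟦ P? x ⟧) ≡ + length (filter P? xs)
    ∑-indicator P? []       = refl
    ∑-indicator P? (x ∷ xs) with P? x
    ... | yes _ = trans (cong (_+_ 1ℤ) (∑-indicator P? xs)) (sym (ℤP.pos-+ 1 _))
    ... | no _  = trans (ℤP.+-identityˡ _) (∑-indicator P? xs)

    ∑-⟦≟⟧-* : (_≟_ : DecidableEquality A) {xs : List A} (g : A → ℤ) {a : A} →
          Unique xs → a ∈ xs → ∑ xs (λ x → ⟦ a ≟ x ⟧ * g x) ≡ g a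
    ∑-⟦≟⟧-* _≟_ {x ∷ xs} g (x≢xs ∷ _) (here refl) = begin
      ⟦ x ≟ x ⟧ * g x + ∑ xs (λ y → ⟦ x ≟ y ⟧ * g y)
        ≡⟨ cong₂ (λ i s → i * g x + s) (⟦⟧-yes (x ≟ x) refl) (∑-cong-∈ xs off) ⟩
      1ℤ * g x + ∑ xs (λ _ → 0ℤ)                      ≡⟨ cong₂ _+_ (ℤP.*-identityˡ (g x)) (∑-zero xs) ⟩
      g x + 0ℤ                                        ≡⟨ ℤP.+-identityʳ (g x) ⟩
      g x                                             ∎
      where
      open ≡-Reasoning
      off : ∀ {y} → y ∈ xs → ⟦ x ≟ y ⟧ * g y ≡ 0ℤ
      off {y} y∈ = trans (cong (_* g y) (⟦⟧-no (x ≟ y) (All.lookup x≢xs y∈))) (ℤP.*-zeroˡ (g y))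
    ∑-⟦≟⟧-* _≟_ {x ∷ xs} g {a} (x≢xs ∷ u) (there a∈) = begin
      ⟦ a ≟ x ⟧ * g x + ∑ xs (λ y → ⟦ a ≟ y ⟧ * g y)
        ≡⟨ cong₂ (λ i s → i * g x + s) (⟦⟧-no (a ≟ x) (λ a≡x → All.lookup x≢xs a∈ (sym a≡x))) (∑-⟦≟⟧-* _≟_ g u a∈) ⟩
      0ℤ * g x + g a                                 ≡⟨ cong (_+ g a) (ℤP.*-zeroˡ (g x)) ⟩
      0ℤ + g a                                       ≡⟨ ℤP.+-identityˡ (g a) ⟩
      g a                                            ∎
      where open ≡-Reasoning

    ∑-⟦≟⟧ : (_≟_ : DecidableEquality A) {xs : List A} {a : A} → Unique xs → a ∈ xs → ∑ xs (λ x → ⟦ a ≟ x ⟧) ≡ 1ℤ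
    ∑-⟦≟⟧ _≟_ {xs} u a∈ = trans (∑-cong xs (λ x → sym (ℤP.*-identityʳ _))) (∑-⟦≟⟧-* _≟_ (λ _ → 1ℤ) u a∈)

    ∑-one : (xs : List A) → ∑ xs (λ _ → 1ℤ) ≡ + length xs
    ∑-one xs = trans (∑-const xs 1ℤ) (ℤP.*-identityʳ (+ length xs))

  module _ {A B : Set} where

    ∑-map : (g : A → B) (xs : List A) (f : B → ℤ) → ∑ (map g xs) f ≡ ∑ xs (f ∘ g)
    ∑-map g []       f = refl
    ∑-map g (x ∷ xs) f = cong (_+_ (f (g x))) (∑-map g xs f)

    ∑-comm : (xs : List A) (ys : List B) (f : A → B → ℤ) →
             ∑ xs (λ x → ∑ ys (f x)) ≡ ∑ ys (λ y → ∑ xs (λ x → f x y))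
    ∑-comm []       ys f = sym (∑-zero ys)
    ∑-comm (x ∷ xs) ys f = trans (cong (_+_ (∑ ys (f x))) (∑-comm xs ys f)) (sym (∑-+ ys (f x) _))

    ∑-*-∑ : (xs : List A) (ys : List B) (f : A → ℤ) (g : B → ℤ) →
            ∑ xs f * ∑ ys g ≡ ∑ xs (λ x → ∑ ys (λ y → f x * g y))
    ∑-*-∑ xs ys f g = begin
      ∑ xs f * ∑ ys g                         ≡⟨ ℤP.*-comm (∑ xs f) (∑ ys g) ⟩
      ∑ ys g * ∑ xs f                         ≡⟨ sym (∑-*ˡ xs (∑ ys g) f) ⟩
      ∑ xs (λ x → ∑ ys g * f x)               ≡⟨ ∑-cong xs (λ x → trans (ℤP.*-comm (∑ ys g) (f x)) (sym (∑-*ˡ ys (f x) g))) ⟩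
      ∑ xs (λ x → ∑ ys (λ y → f x * g y))     ∎
      where open ≡-Reasoning

  ∑-cartesianProductWith : {A B C : Set} (g : A → B → C) (xs : List A) (ys : List B) (f : C → ℤ) →
                           ∑ (cartesianProductWith g xs ys) f ≡ ∑ xs (λ x → ∑ ys (λ y → f (g x y)))
  ∑-cartesianProductWith g []       ys f = refl
  ∑-cartesianProductWith g (x ∷ xs) ys f =
    trans (∑-++ (map (g x) ys) _ f) (cong₂ _+_ (∑-map (g x) ys f) (∑-cartesianProductWith g xs ys f))

open Sums


module IntegerFacts where

  open import Data.Integer using (_+_; _*_; -_; _-_; _≤_; _<_)

  *-nonNeg : ∀ {x y} → 0ℤ ≤ x → 0ℤ ≤ y → 0ℤ ≤ x * y
  *-nonNeg {x} 0≤x 0≤y =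
    subst (_≤ x * _) (ℤP.*-zeroʳ x) (ℤP.*-monoˡ-≤-nonNeg x {{ℤ.nonNegative 0≤x}} 0≤y)

  square-nonNeg : ∀ x → 0ℤ ≤ x * x
  square-nonNeg x with ℤP.≤-total 0ℤ x
  ... | inj₁ 0≤x = *-nonNeg 0≤x 0≤x
  ... | inj₂ x≤0 = subst (0ℤ ≤_) (neg-square x) (*-nonNeg (ℤP.neg-mono-≤ x≤0) (ℤP.neg-mono-≤ x≤0))
    where neg-square : ∀ x → - x * - x ≡ x * x
          neg-square = solve-∀

  *-cancelˡ-nonNeg : ∀ {c x} → 0ℤ < c → 0ℤ ≤ c * x → 0ℤ ≤ x
  *-cancelˡ-nonNeg {c} {x} 0<c 0≤cx =
    ℤP.*-cancelˡ-≤-pos 0ℤ x c {{ℤ.positive 0<c}} (subst (_≤ c * x) (sym (ℤP.*-zeroʳ c)) 0≤cx)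

  square-mono-≤ : ∀ {r e} → - e ≤ r → r ≤ e → r * r ≤ e * e
  square-mono-≤ {r} {e} -e≤r r≤e = ℤP.0≤i-j⇒j≤i (subst (0ℤ ≤_) (difference-of-squares e r)
    (*-nonNeg (ℤP.i≤j⇒0≤j-i r≤e) (ℤP.i≤j⇒0≤j-i -e≤r)))
    where
    difference-of-squares : ∀ e r → (e - r) * (r - - e) ≡ e * e - r * r
    difference-of-squares = solve-∀

  *-pos : ∀ {x y} → 0ℤ < x → 0ℤ < y → 0ℤ < x * y
  *-pos {x} 0<x 0<y = subst (_< x * _) (ℤP.*-zeroʳ x) (ℤP.*-monoˡ-<-pos x {{ℤ.positive 0<x}} 0<y)

  0<r*s⇒0<s : ∀ r s → 0ℤ < r * + s → 0 ℕ.< s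
  0<r*s⇒0<s r zero    0<r*0 = ⊥-elim (ℤP.<-irrefl refl (ℤP.<-≤-trans 0<r*0 (ℤP.≤-reflexive (ℤP.*-zeroʳ r))))
  0<r*s⇒0<s _ (suc s) _     = ℕ.s≤s ℕ.z≤n

open IntegerFacts


module Variance {A : Set} (ts : List A) where

  open import Data.Integer using (_+_; _*_; -_; _-_; _≤_; _<_)

  Q : ℤ
  Q = + length ts

  ⟨_,_⟩ : (A → ℤ) → (A → ℤ) → ℤ
  ⟨ f , g ⟩ = ∑ ts (λ t → f t * g t)

  centred : (A → ℤ) → ℤ → A → ℤ
  centred f a t = Q * f t - a

  ⟨centred,centred⟩ : (f g : A → ℤ) {a b : ℤ} → ∑ ts f ≡ a → ∑ ts g ≡ b →
                      ⟨ centred f a , centred g b ⟩ ≡ Q * (Q * ⟨ f , g ⟩ - a * b)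
  ⟨centred,centred⟩ f g {a} {b} ∑f≡a ∑g≡b = begin
    ∑ ts (λ t → (Q * f t - a) * (Q * g t - b))
      ≡⟨ ∑-cong ts (λ t → expand Q a b (f t) (g t)) ⟩
    ∑ ts (λ t → Q * Q * (f t * g t) + (- (Q * b) * f t + (- (a * Q) * g t + a * b)))
      ≡⟨ ∑-+ ts (λ t → Q * Q * (f t * g t)) _ ⟩
    ∑ ts (λ t → Q * Q * (f t * g t)) + ∑ ts (λ t → - (Q * b) * f t + (- (a * Q) * g t + a * b))
      ≡⟨ cong₂ _+_ (∑-*ˡ ts (Q * Q) (λ t → f t * g t)) (∑-+ ts (λ t → - (Q * b) * f t) _) ⟩
    Q * Q * ⟨ f , g ⟩ + (∑ ts (λ t → - (Q * b) * f t) + ∑ ts (λ t → - (a * Q) * g t + a * b))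
      ≡⟨ cong (λ s → Q * Q * ⟨ f , g ⟩ + (∑ ts (λ t → - (Q * b) * f t) + s)) (∑-+ ts (λ t → - (a * Q) * g t) _) ⟩
    Q * Q * ⟨ f , g ⟩ + (∑ ts (λ t → - (Q * b) * f t) + (∑ ts (λ t → - (a * Q) * g t) + ∑ ts (λ _ → a * b)))
      ≡⟨ cong₂ (λ x y → Q * Q * ⟨ f , g ⟩ + (x + y))
           (trans (∑-*ˡ ts (- (Q * b)) f) (cong (- (Q * b) *_) ∑f≡a))
           (cong₂ _+_ (trans (∑-*ˡ ts (- (a * Q)) g) (cong (- (a * Q) *_) ∑g≡b)) (∑-const ts (a * b))) ⟩
    Q * Q * ⟨ f , g ⟩ + (- (Q * b) * a + (- (a * Q) * b + Q * (a * b)))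
      ≡⟨ collect Q ⟨ f , g ⟩ a b ⟩
    Q * (Q * ⟨ f , g ⟩ - a * b) ∎
    where
    open ≡-Reasoning
    expand : ∀ Q a b x y → (Q * x - a) * (Q * y - b) ≡ Q * Q * (x * y) + (- (Q * b) * x + (- (a * Q) * y + a * b))
    expand = solve-∀
    collect : ∀ Q X a b → Q * Q * X + (- (Q * b) * a + (- (a * Q) * b + Q * (a * b))) ≡ Q * (Q * X - a * b)
    collect = solve-∀

  ∑-square-+ : (u v : A → ℤ) (s : ℤ) →
               ∑ ts (λ t → (u t + s * v t) * (u t + s * v t)) ≡ ⟨ u , u ⟩ + (s * s * ⟨ v , v ⟩ + + 2 * s * ⟨ u , v ⟩)
  ∑-square-+ u v s = begin
    ∑ ts (λ t → (u t + s * v t) * (u t + s * v t))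
      ≡⟨ ∑-cong ts (λ t → expand s (u t) (v t)) ⟩
    ∑ ts (λ t → u t * u t + (s * s * (v t * v t) + + 2 * s * (u t * v t)))
      ≡⟨ ∑-+ ts (λ t → u t * u t) _ ⟩
    ⟨ u , u ⟩ + ∑ ts (λ t → s * s * (v t * v t) + + 2 * s * (u t * v t))
      ≡⟨ cong (_+_ ⟨ u , u ⟩) (trans (∑-+ ts (λ t → s * s * (v t * v t)) _)
           (cong₂ _+_ (∑-*ˡ ts (s * s) (λ t → v t * v t)) (∑-*ˡ ts (+ 2 * s) (λ t → u t * v t)))) ⟩
    ⟨ u , u ⟩ + (s * s * ⟨ v , v ⟩ + + 2 * s * ⟨ u , v ⟩) ∎
    where
    open ≡-Reasoning
    expand : ∀ s x y → (x + s * y) * (x + s * y) ≡ x * x + (s * s * (y * y) + + 2 * s * (x * y))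
    expand = solve-∀

  module _ (0<Q : 0ℤ < Q) where

    variance-nonNeg : (f : A → ℤ) {a : ℤ} → ∑ ts f ≡ a → 0ℤ ≤ Q * ⟨ f , f ⟩ - a * a
    variance-nonNeg f {a} ∑f≡a = *-cancelˡ-nonNeg 0<Q (subst (0ℤ ≤_) (⟨centred,centred⟩ f f ∑f≡a ∑f≡a)
      (∑-nonNeg ts (λ {t} _ → square-nonNeg (centred f a t))))

    covariance-bounded : (f g : A → ℤ) {a C : ℤ} → ∑ ts f ≡ a → ∑ ts g ≡ a → ⟨ f , f ⟩ ≡ C → ⟨ g , g ⟩ ≡ C →
                         - (Q * C - a * a) ≤ Q * ⟨ f , g ⟩ - a * a × Q * ⟨ f , g ⟩ - a * a ≤ Q * C - a * a
    covariance-bounded f g {a} {C} ∑f≡a ∑g≡a ⟨f,f⟩≡C ⟨g,g⟩≡C =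
      ℤP.0≤i-j⇒j≤i (subst (0ℤ ≤_) (plus-minus E R) (*-cancelˡ-nonNeg 2Q>0 (with-sign 1ℤ (sum-case Q E R)))) ,
      ℤP.0≤i-j⇒j≤i (*-cancelˡ-nonNeg 2Q>0 (with-sign (- 1ℤ) (difference-case Q E R)))
      where
      E = Q * C - a * a
      R = Q * ⟨ f , g ⟩ - a * a
      u = centred f a
      v = centred g a
      ⟨u,u⟩ : ⟨ u , u ⟩ ≡ Q * E
      ⟨u,u⟩ = trans (⟨centred,centred⟩ f f ∑f≡a ∑f≡a) (cong (λ c → Q * (Q * c - a * a)) ⟨f,f⟩≡C)
      ⟨v,v⟩ : ⟨ v , v ⟩ ≡ Q * E
      ⟨v,v⟩ = trans (⟨centred,centred⟩ g g ∑g≡a ∑g≡a) (cong (λ c → Q * (Q * c - a * a)) ⟨g,g⟩≡C)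
      with-sign : (s : ℤ) {X : ℤ} → Q * E + (s * s * (Q * E) + + 2 * s * (Q * R)) ≡ X → 0ℤ ≤ X
      with-sign s eq = subst (0ℤ ≤_)
        (trans (∑-square-+ u v s) (trans (cong₂ (λ x y → x + (s * s * y + + 2 * s * ⟨ u , v ⟩)) ⟨u,u⟩ ⟨v,v⟩)
          (trans (cong (λ z → Q * E + (s * s * (Q * E) + + 2 * s * z)) (⟨centred,centred⟩ f g ∑f≡a ∑g≡a)) eq)))
        (∑-nonNeg ts (λ {t} _ → square-nonNeg (u t + s * v t)))
      2Q>0 : 0ℤ < + 2 * Q
      2Q>0 = ℤP.*-monoˡ-<-pos (+ 2) 0<Q
      sum-case : ∀ Q E R → Q * E + (1ℤ * 1ℤ * (Q * E) + + 2 * 1ℤ * (Q * R)) ≡ + 2 * Q * (E + R)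
      sum-case = solve-∀
      difference-case : ∀ Q E R → Q * E + (- 1ℤ * - 1ℤ * (Q * E) + + 2 * - 1ℤ * (Q * R)) ≡ + 2 * Q * (E - R)
      difference-case = solve-∀
      plus-minus : ∀ E R → E + R ≡ R - - E
      plus-minus = solve-∀


module VectorSpace (F : FiniteField) where

  open import Data.Integer using () renaming (_+_ to _+ℤ_; _*_ to _*ℤ_)

  open FiniteField F using (q; isCommutativeRing; inverse)

  ring : CommutativeRing 0ℓ 0ℓ
  ring = record { isCommutativeRing = isCommutativeRing }

  open CommutativeRing ring public using (_+_; _*_; -_; _-_; 0#; 1#)
  open CommutativeRing ring using (+-assoc; +-identityˡ; +-identityʳ; *-identityˡ; *-identityʳ; *-comm; *-assoc; zeroˡ)
  open import Algebra.Properties.Ring (CommutativeRing.ring ring)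
    using (x[y-z]≈xy-xz; -‿injective; +-cancelˡ; +-cancelʳ; x≈z//y; //-rightDividesˡ; //-rightDividesʳ; x∙y⁻¹≈ε⇒x≈y)
  open import Tactic.RingSolver.NonReflective (fromCommutativeRing ring (λ _ → nothing))
    using (solve; _⊜_; _⊕_; _⊗_)

  c+ty≡c′+tz⇔t[y-z]≡c′-c : ∀ c c' y z t → c + t * y ≡ c' + t * z ⇔ t * (y - z) ≡ c' - c
  c+ty≡c′+tz⇔t[y-z]≡c′-c c c' y z t = mk⇔ to from
    where
    open ≡-Reasoning
    to : c + t * y ≡ c' + t * z → t * (y - z) ≡ c' - c
    to eq = trans (x[y-z]≈xy-xz t y z) (x≈z//y (t * y - t * z) c c' (begin
      (t * y - t * z) + c   ≡⟨ solve 3 (λ c ty mtz → ((ty ⊕ mtz) ⊕ c) ⊜ ((c ⊕ ty) ⊕ mtz)) refl c (t * y) (- (t * z)) ⟩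
      (c + t * y) - t * z   ≡⟨ cong (_- t * z) eq ⟩
      (c' + t * z) - t * z  ≡⟨ //-rightDividesʳ (t * z) c' ⟩
      c'                    ∎))
    from : t * (y - z) ≡ c' - c → c + t * y ≡ c' + t * z
    from eq = begin
      c + t * y                   ≡⟨ cong (_+_ c) (sym (//-rightDividesˡ (t * z) (t * y))) ⟩
      c + ((t * y - t * z) + t * z) ≡⟨ cong (λ s → c + (s + t * z)) (trans (sym (x[y-z]≈xy-xz t y z)) eq) ⟩
      c + ((c' - c) + t * z)        ≡⟨ solve 3 (λ c d tz → (c ⊕ (d ⊕ tz)) ⊜ ((d ⊕ c) ⊕ tz)) refl c (c' - c) (t * z) ⟩
      ((c' - c) + c) + t * z        ≡⟨ cong (_+ t * z) (//-rightDividesˡ c c') ⟩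
      c' + t * z                    ∎

  c+ty≡c′+tz-unique-solution : ∀ c c' y z → y ≢ z → ∃[ t₀ ] ∀ t → c + t * y ≡ c' + t * z ⇔ t₀ ≡ t
  c+ty≡c′+tz-unique-solution c c' y z y≢z = (c' - c) * w , λ t → mk⇔
    (λ eq → trans (cong (_* w) (sym (Equivalence.to (c+ty≡c′+tz⇔t[y-z]≡c′-c c c' y z t) eq))) (cancel t))
    (λ { refl → Equivalence.from (c+ty≡c′+tz⇔t[y-z]≡c′-c c c' y z _) (trans (*-assoc (c' - c) w (y - z))
                   (trans (cong ((c' - c) *_) (trans (*-comm w (y - z)) [y-z]w≡1)) (*-identityʳ (c' - c)))) })
    where
    w = proj₁ (inverse (y - z) (λ y-z≡0 → y≢z (x∙y⁻¹≈ε⇒x≈y y z y-z≡0)))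
    [y-z]w≡1 = proj₂ (inverse (y - z) (λ y-z≡0 → y≢z (x∙y⁻¹≈ε⇒x≈y y z y-z≡0)))
    cancel : ∀ t → t * (y - z) * w ≡ t
    cancel t = trans (*-assoc t (y - z) w) (trans (cong (t *_) [y-z]w≡1) (*-identityʳ t))

  ⟦+≟⟧ : ∀ a b t → ⟦ a + b ≟ t ⟧ ≡ ⟦ a ≟ t - b ⟧
  ⟦+≟⟧ a b t = ⟦⟧-⇔ (a + b ≟ t) (a ≟ t - b) (x≈z//y a b t) (λ a≡t-b → trans (cong (_+ b) a≡t-b) (//-rightDividesˡ b t))

  ⟦-≟-⟧ : ∀ t a b → ⟦ t - a ≟ t - b ⟧ ≡ ⟦ a ≟ b ⟧
  ⟦-≟-⟧ t a b = ⟦⟧-⇔ (t - a ≟ t - b) (a ≟ b) (λ e → -‿injective (+-cancelˡ t (- a) (- b) e)) (cong (_-_ t))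

  ∑-⟦c+ty≟c′+tz⟧ : ∀ c c' {y z} → y ≢ z → ∑ (allFin q) (λ t → ⟦ c + t * y ≟ c' + t * z ⟧) ≡ 1ℤ
  ∑-⟦c+ty≟c′+tz⟧ c c' {y} {z} y≢z = trans
    (∑-cong (allFin q) (λ t → ⟦⟧-⇔ (c + t * y ≟ c' + t * z) (t₀ ≟ t) (Equivalence.to (root t)) (Equivalence.from (root t))))
    (∑-⟦≟⟧ _≟_ (allFin⁺ q) (∈-allFin t₀))
    where
    t₀ = proj₁ (c+ty≡c′+tz-unique-solution c c' y z y≢z)
    root = proj₂ (c+ty≡c′+tz-unique-solution c c' y z y≢z)

  V : ℕ → Set
  V = Vector F

  infix  4 _≟ⱽ_
  infixl 6 _+ⱽ_

  _≟ⱽ_ : ∀ {n} → DecidableEquality (V n)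
  _≟ⱽ_ = VecP.≡-dec _≟_

  _+ⱽ_ : ∀ {n} → V n → V n → V n
  _+ⱽ_ = zipWith _+_

  dot-+ⱽ : ∀ {n} (ξ x y : V n) → dot F ξ (x +ⱽ y) ≡ dot F ξ x + dot F ξ y
  dot-+ⱽ []      []      []      = sym (+-identityʳ 0#)
  dot-+ⱽ (a ∷ ξ) (b ∷ x) (c ∷ y) = trans (cong (_+_ (a * (b + c))) (dot-+ⱽ ξ x y))
    (solve 5 (λ a b c X Y → ((a ⊗ (b ⊕ c)) ⊕ (X ⊕ Y)) ⊜ (((a ⊗ b) ⊕ X) ⊕ ((a ⊗ c) ⊕ Y))) refl a b c (dot F ξ x) (dot F ξ y))

  allVectors-unique : ∀ n → Unique (allVectors F n)
  allVectors-unique zero    = [] ∷ []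
  allVectors-unique (suc n) = cartesianProductWith⁺ _∷_ VecP.∷-injective (allFin⁺ q) (allVectors-unique n)

  ∑-allVectors-suc : ∀ k (f : V (suc k) → ℤ) →
                     ∑ (allVectors F (suc k)) f ≡ ∑ (allFin q) (λ t → ∑ (allVectors F k) (λ ξ → f (t ∷ ξ)))
  ∑-allVectors-suc k = ∑-cartesianProductWith _∷_ (allFin q) (allVectors F k)

  N : ℕ → ℤ
  N k = + length (allVectors F k)

  ∑-const-allFin : ∀ c → ∑ (allFin q) (λ _ → c) ≡ + q *ℤ c
  ∑-const-allFin c = trans (∑-const (allFin q) c) (cong (λ n → + n *ℤ c) (ListP.length-tabulate {n = q} (λ i → i)))

  N-suc : ∀ k → N (suc k) ≡ + q *ℤ N k
  N-suc k = begin
    N (suc k)                                    ≡⟨ sym (∑-one (allVectors F (suc k))) ⟩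
    ∑ (allVectors F (suc k)) (λ _ → 1ℤ)          ≡⟨ ∑-allVectors-suc k (λ _ → 1ℤ) ⟩
    ∑ (allFin q) (λ _ → ∑ (allVectors F k) (λ _ → 1ℤ)) ≡⟨ ∑-const-allFin _ ⟩
    + q *ℤ ∑ (allVectors F k) (λ _ → 1ℤ)        ≡⟨ cong (+ q *ℤ_) (∑-one (allVectors F k)) ⟩
    + q *ℤ N k                                   ∎
    where open ≡-Reasoning

  0<q : 0 ℕ.< q
  0<q = ℕ.>-nonZero⁻¹ q {{nonZeroIndex 0#}}

  0<N : ∀ k → 0ℤ ℤ.< N k
  0<N zero    = ℤ.+<+ (ℕ.s≤s ℕ.z≤n)
  0<N (suc k) = subst (0ℤ ℤ.<_) (sym (N-suc k)) (*-pos (ℤ.+<+ 0<q) (0<N k))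

  ⟦+≟+⟧-cancelʳ : ∀ a b s → ⟦ a + s ≟ b + s ⟧ ≡ ⟦ a ≟ b ⟧
  ⟦+≟+⟧-cancelʳ a b s = ⟦⟧-⇔ (a + s ≟ b + s) (a ≟ b) (+-cancelʳ s a b) (cong (_+ s))

  ∑-⟦c+ξy≟c′+ξz⟧ : ∀ k {y z : V (suc k)} → y ≢ z → ∀ c c' →
    ∑ (allVectors F (suc k)) (λ ξ → ⟦ c + dot F ξ y ≟ c' + dot F ξ z ⟧) ≡ N k
  ∑-⟦c+ξy≟c′+ξz⟧ k {y₀ ∷ y} {z₀ ∷ z} y≢z c c' with y ≟ⱽ z
  ... | yes refl = begin
    ∑ (allVectors F (suc k)) (λ ξ → ⟦ c + dot F ξ (y₀ ∷ y) ≟ c' + dot F ξ (z₀ ∷ y) ⟧)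
      ≡⟨ ∑-allVectors-suc k _ ⟩
    ∑ (allFin q) (λ t → ∑ (allVectors F k) (λ ξ → ⟦ c + (t * y₀ + dot F ξ y) ≟ c' + (t * z₀ + dot F ξ y) ⟧))
      ≡⟨ ∑-cong (allFin q) (λ t → ∑-cong (allVectors F k) (λ ξ → trans
           (cong₂ (λ a b → ⟦ a ≟ b ⟧) (sym (+-assoc c _ _)) (sym (+-assoc c' _ _)))
           (⟦+≟+⟧-cancelʳ (c + t * y₀) (c' + t * z₀) (dot F ξ y)))) ⟩
    ∑ (allFin q) (λ t → ∑ (allVectors F k) (λ _ → ⟦ c + t * y₀ ≟ c' + t * z₀ ⟧))
      ≡⟨ ∑-cong (allFin q) (λ t → ∑-const (allVectors F k) _) ⟩
    ∑ (allFin q) (λ t → N k *ℤ ⟦ c + t * y₀ ≟ c' + t * z₀ ⟧)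
      ≡⟨ ∑-*ˡ (allFin q) (N k) _ ⟩
    N k *ℤ ∑ (allFin q) (λ t → ⟦ c + t * y₀ ≟ c' + t * z₀ ⟧)
      ≡⟨ cong (N k *ℤ_) (∑-⟦c+ty≟c′+tz⟧ c c' (λ y₀≡z₀ → y≢z (cong (_∷ y) y₀≡z₀))) ⟩
    N k *ℤ 1ℤ
      ≡⟨ ℤP.*-identityʳ (N k) ⟩
    N k ∎
    where open ≡-Reasoning
  ∑-⟦c+ξy≟c′+ξz⟧ zero    {_ ∷ []} {_ ∷ []} _ c c' | no []≢[] = ⊥-elim ([]≢[] refl)
  ∑-⟦c+ξy≟c′+ξz⟧ (suc k) {y₀ ∷ y} {z₀ ∷ z} _ c c' | no y≢z = begin
    ∑ (allVectors F (suc (suc k))) (λ ξ → ⟦ c + dot F ξ (y₀ ∷ y) ≟ c' + dot F ξ (z₀ ∷ z) ⟧)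
      ≡⟨ ∑-allVectors-suc (suc k) _ ⟩
    ∑ (allFin q) (λ t → ∑ (allVectors F (suc k)) (λ ξ → ⟦ c + (t * y₀ + dot F ξ y) ≟ c' + (t * z₀ + dot F ξ z) ⟧))
      ≡⟨ ∑-cong (allFin q) (λ t → trans
           (∑-cong (allVectors F (suc k)) (λ ξ → cong₂ (λ a b → ⟦ a ≟ b ⟧) (sym (+-assoc c _ _)) (sym (+-assoc c' _ _))))
           (∑-⟦c+ξy≟c′+ξz⟧ k y≢z (c + t * y₀) (c' + t * z₀))) ⟩
    ∑ (allFin q) (λ _ → N k)
      ≡⟨ ∑-const-allFin (N k) ⟩
    + q *ℤ N k
      ≡⟨ sym (N-suc k) ⟩
    N (suc k) ∎
    where open ≡-Reasoning

  -- one vector on each line through the origin: the one whose first nonzero coordinate is 1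
  projective : (n : ℕ) → List (V n)
  projective zero    = []
  projective (suc n) = map (1# ∷_) (allVectors F n) ++ map (0# ∷_) (projective n)

  G : ℕ → ℤ
  G k = + length (projective k)

  G-suc : ∀ k → G (suc k) ≡ N k +ℤ G k
  G-suc k = trans (cong +_ (trans (ListP.length-++ (map (1# ∷_) (allVectors F k)))
                              (cong₂ ℕ._+_ (ListP.length-map _ (allVectors F k)) (ListP.length-map _ (projective k)))))
                  (ℤP.pos-+ (length (allVectors F k)) (length (projective k)))

  G-recurrence : ∀ k → G (suc k) ≡ 1ℤ +ℤ + q *ℤ G k
  G-recurrence zero    = trans (G-suc zero) (cong (1ℤ +ℤ_) (sym (ℤP.*-zeroʳ (+ q))))
  G-recurrence (suc k) = begin
    G (suc (suc k))                   ≡⟨ G-suc (suc k) ⟩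
    N (suc k) +ℤ G (suc k)            ≡⟨ cong₂ _+ℤ_ (N-suc k) (G-recurrence k) ⟩
    + q *ℤ N k +ℤ (1ℤ +ℤ + q *ℤ G k)  ≡⟨ rearrange (+ q) (N k) (G k) ⟩
    1ℤ +ℤ + q *ℤ (N k +ℤ G k)         ≡⟨ cong (λ g → 1ℤ +ℤ + q *ℤ g) (sym (G-suc k)) ⟩
    1ℤ +ℤ + q *ℤ G (suc k)            ∎
    where
    open ≡-Reasoning
    rearrange : ∀ a b c → a *ℤ b +ℤ (1ℤ +ℤ a *ℤ c) ≡ 1ℤ +ℤ a *ℤ (b +ℤ c)
    rearrange = solve-∀

  ∑-projective-suc : ∀ k (f : V (suc k) → ℤ) →
    ∑ (projective (suc k)) f ≡ ∑ (allVectors F k) (f ∘ (1# ∷_)) +ℤ ∑ (projective k) (f ∘ (0# ∷_))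
  ∑-projective-suc k f = trans (∑-++ (map (1# ∷_) (allVectors F k)) _ f)
    (cong₂ _+ℤ_ (∑-map (1# ∷_) (allVectors F k) f) (∑-map (0# ∷_) (projective k) f))

  ⟦∷≟ⱽ∷⟧ : ∀ {n} a b (x : V n) → ⟦ a ∷ x ≟ⱽ b ∷ x ⟧ ≡ ⟦ a ≟ b ⟧
  ⟦∷≟ⱽ∷⟧ a b x = ⟦⟧-⇔ (a ∷ x ≟ⱽ b ∷ x) (a ≟ b) VecP.∷-injectiveˡ (cong (_∷ x))

  ∑-projective-⟦dot≟dot⟧-∷ : ∀ k y₀ z₀ (y z : V k) →
    ∑ (projective (suc k)) (λ ξ → ⟦ dot F ξ (y₀ ∷ y) ≟ dot F ξ (z₀ ∷ z) ⟧)
      ≡ ∑ (allVectors F k) (λ ξ → ⟦ y₀ + dot F ξ y ≟ z₀ + dot F ξ z ⟧) +ℤ ∑ (projective k) (λ ξ → ⟦ dot F ξ y ≟ dot F ξ z ⟧)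
  ∑-projective-⟦dot≟dot⟧-∷ k y₀ z₀ y z = trans (∑-projective-suc k _) (cong₂ _+ℤ_
    (∑-cong (allVectors F k) (λ ξ → cong₂ (λ a b → ⟦ a + dot F ξ y ≟ b + dot F ξ z ⟧) (*-identityˡ y₀) (*-identityˡ z₀)))
    (∑-cong (projective k) (λ ξ → cong₂ (λ a b → ⟦ a ≟ b ⟧) (0*a+d y₀ (dot F ξ y)) (0*a+d z₀ (dot F ξ z)))))
    where
    0*a+d : ∀ a d → 0# * a + d ≡ d
    0*a+d a d = trans (cong (_+ d) (zeroˡ a)) (+-identityˡ d)

  ∑-projective-⟦dot≟dot⟧-∷≡∷ : ∀ k y₀ z₀ (y : V k) →
    ∑ (projective (suc k)) (λ ξ → ⟦ dot F ξ (y₀ ∷ y) ≟ dot F ξ (z₀ ∷ y) ⟧) ≡ G k +ℤ ⟦ y₀ ∷ y ≟ⱽ z₀ ∷ y ⟧ *ℤ N k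
  ∑-projective-⟦dot≟dot⟧-∷≡∷ k y₀ z₀ y = begin
    ∑ (projective (suc k)) (λ ξ → ⟦ dot F ξ (y₀ ∷ y) ≟ dot F ξ (z₀ ∷ y) ⟧)
      ≡⟨ ∑-projective-⟦dot≟dot⟧-∷ k y₀ z₀ y y ⟩
    ∑ (allVectors F k) (λ ξ → ⟦ y₀ + dot F ξ y ≟ z₀ + dot F ξ y ⟧) +ℤ ∑ (projective k) (λ ξ → ⟦ dot F ξ y ≟ dot F ξ y ⟧)
      ≡⟨ cong₂ _+ℤ_ (∑-cong (allVectors F k) (λ ξ → ⟦+≟+⟧-cancelʳ y₀ z₀ (dot F ξ y)))
                    (∑-cong (projective k) (λ ξ → ⟦⟧-yes (dot F ξ y ≟ dot F ξ y) refl)) ⟩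
    ∑ (allVectors F k) (λ _ → ⟦ y₀ ≟ z₀ ⟧) +ℤ ∑ (projective k) (λ _ → 1ℤ)
      ≡⟨ cong₂ _+ℤ_ (∑-const (allVectors F k) ⟦ y₀ ≟ z₀ ⟧) (∑-one (projective k)) ⟩
    N k *ℤ ⟦ y₀ ≟ z₀ ⟧ +ℤ G k
      ≡⟨ ℤP.+-comm (N k *ℤ ⟦ y₀ ≟ z₀ ⟧) (G k) ⟩
    G k +ℤ N k *ℤ ⟦ y₀ ≟ z₀ ⟧
      ≡⟨ cong (G k +ℤ_) (trans (ℤP.*-comm (N k) ⟦ y₀ ≟ z₀ ⟧) (cong (_*ℤ N k) (sym (⟦∷≟ⱽ∷⟧ y₀ z₀ y)))) ⟩
    G k +ℤ ⟦ y₀ ∷ y ≟ⱽ z₀ ∷ y ⟧ *ℤ N k ∎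
    where open ≡-Reasoning

  ∑-projective-⟦dot≟dot⟧ : ∀ k (y z : V (suc k)) →
    ∑ (projective (suc k)) (λ ξ → ⟦ dot F ξ y ≟ dot F ξ z ⟧) ≡ G k +ℤ ⟦ y ≟ⱽ z ⟧ *ℤ N k
  ∑-projective-⟦dot≟dot⟧ zero    (y₀ ∷ []) (z₀ ∷ []) = ∑-projective-⟦dot≟dot⟧-∷≡∷ zero y₀ z₀ []
  ∑-projective-⟦dot≟dot⟧ (suc k) (y₀ ∷ y) (z₀ ∷ z) = by-cases (y ≟ⱽ z)
    where
    open ≡-Reasoning
    by-cases : Dec (y ≡ z) →
      ∑ (projective (suc (suc k))) (λ ξ → ⟦ dot F ξ (y₀ ∷ y) ≟ dot F ξ (z₀ ∷ z) ⟧)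
        ≡ G (suc k) +ℤ ⟦ y₀ ∷ y ≟ⱽ z₀ ∷ z ⟧ *ℤ N (suc k)
    by-cases (yes refl) = ∑-projective-⟦dot≟dot⟧-∷≡∷ (suc k) y₀ z₀ y
    by-cases (no y≢z)   = begin
      ∑ (projective (suc (suc k))) (λ ξ → ⟦ dot F ξ (y₀ ∷ y) ≟ dot F ξ (z₀ ∷ z) ⟧)
        ≡⟨ ∑-projective-⟦dot≟dot⟧-∷ (suc k) y₀ z₀ y z ⟩
      ∑ (allVectors F (suc k)) (λ ξ → ⟦ y₀ + dot F ξ y ≟ z₀ + dot F ξ z ⟧)
        +ℤ ∑ (projective (suc k)) (λ ξ → ⟦ dot F ξ y ≟ dot F ξ z ⟧)
        ≡⟨ cong₂ _+ℤ_ (∑-⟦c+ξy≟c′+ξz⟧ k y≢z y₀ z₀) (∑-projective-⟦dot≟dot⟧ k y z) ⟩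
      N k +ℤ (G k +ℤ ⟦ y ≟ⱽ z ⟧ *ℤ N k)
        ≡⟨ cong (λ i → N k +ℤ (G k +ℤ i *ℤ N k)) (⟦⟧-no (y ≟ⱽ z) y≢z) ⟩
      N k +ℤ (G k +ℤ 0ℤ)
        ≡⟨ trans (cong (N k +ℤ_) (ℤP.+-identityʳ (G k))) (sym (G-suc k)) ⟩
      G (suc k)
        ≡⟨ sym (ℤP.+-identityʳ (G (suc k))) ⟩
      G (suc k) +ℤ 0ℤ *ℤ N (suc k)
        ≡⟨ cong (λ i → G (suc k) +ℤ i *ℤ N (suc k)) (sym (⟦⟧-no (y₀ ∷ y ≟ⱽ z₀ ∷ z) (y≢z ∘ VecP.∷-injectiveʳ))) ⟩
      G (suc k) +ℤ ⟦ y₀ ∷ y ≟ⱽ z₀ ∷ z ⟧ *ℤ N (suc k) ∎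


module Bogolyubov (F : FiniteField) where

  open import Data.Integer using (_+_; _*_; -_; _-_; _≤_; _<_)

  open FiniteField F using (q)
  open VectorSpace F hiding (_*_; -_) renaming (_+_ to _+F_; _-_ to _-F_)
  open Variance (allFin q) using (Q; ⟨_,_⟩; variance-nonNeg; covariance-bounded; ⟨centred,centred⟩)

  count : {X : Set} → List X → (X → Scalar F) → Scalar F → ℤ
  count xs f t = ∑ xs (λ x → ⟦ f x ≟ t ⟧)

  ∑-count : {X : Set} (xs : List X) (f : X → Scalar F) → ∑ (allFin q) (count xs f) ≡ + length xs
  ∑-count xs f = begin
    ∑ (allFin q) (λ t → ∑ xs (λ x → ⟦ f x ≟ t ⟧)) ≡⟨ ∑-comm (allFin q) xs _ ⟩
    ∑ xs (λ x → ∑ (allFin q) (λ t → ⟦ f x ≟ t ⟧)) ≡⟨ ∑-cong xs (λ x → ∑-⟦≟⟧ _≟_ (allFin⁺ q) (∈-allFin (f x))) ⟩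
    ∑ xs (λ _ → 1ℤ)                               ≡⟨ ∑-one xs ⟩
    + length xs                                   ∎
    where open ≡-Reasoning

  ⟨count,count⟩ : {X Y : Set} (xs : List X) (ys : List Y) (f : X → Scalar F) (g : Y → Scalar F) →
                  ⟨ count xs f , count ys g ⟩ ≡ ∑ xs (λ x → ∑ ys (λ y → ⟦ f x ≟ g y ⟧))
  ⟨count,count⟩ xs ys f g = begin
    ∑ (allFin q) (λ t → count xs f t * count ys g t)
      ≡⟨ ∑-cong (allFin q) (λ t → ∑-*-∑ xs ys _ _) ⟩
    ∑ (allFin q) (λ t → ∑ xs (λ x → ∑ ys (λ y → ⟦ f x ≟ t ⟧ * ⟦ g y ≟ t ⟧)))
      ≡⟨ ∑-comm (allFin q) xs _ ⟩
    ∑ xs (λ x → ∑ (allFin q) (λ t → ∑ ys (λ y → ⟦ f x ≟ t ⟧ * ⟦ g y ≟ t ⟧)))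
      ≡⟨ ∑-cong xs (λ x → ∑-comm (allFin q) ys _) ⟩
    ∑ xs (λ x → ∑ ys (λ y → ∑ (allFin q) (λ t → ⟦ f x ≟ t ⟧ * ⟦ g y ≟ t ⟧)))
      ≡⟨ ∑-cong xs (λ x → ∑-cong ys (λ y → trans (∑-⟦≟⟧-* _≟_ (λ t → ⟦ g y ≟ t ⟧) (allFin⁺ q) (∈-allFin (f x)))
                                                 (⟦⟧-⇔ (g y ≟ f x) (f x ≟ g y) sym sym))) ⟩
    ∑ xs (λ x → ∑ ys (λ y → ⟦ f x ≟ g y ⟧)) ∎
    where open ≡-Reasoning

  Q≡q : Q ≡ + q
  Q≡q = cong +_ (ListP.length-tabulate {n = q} (λ i → i))

  0<Q : 0ℤ < Q
  0<Q = subst (0ℤ <_) (sym Q≡q) (ℤ.+<+ 0<q)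

  module Energies {n : ℕ} (A : List (V n)) where

    a : ℤ
    a = + length A

    pairs : List (V n × V n)
    pairs = cartesianProduct A A

    length-pairs : + length pairs ≡ a * a
    length-pairs = begin
      + length pairs                         ≡⟨ sym (∑-one pairs) ⟩
      ∑ pairs (λ _ → 1ℤ)                     ≡⟨ ∑-cartesianProductWith _,_ A A (λ _ → 1ℤ) ⟩
      ∑ A (λ _ → ∑ A (λ _ → 1ℤ))             ≡⟨ ∑-const A _ ⟩
      a * ∑ A (λ _ → 1ℤ)                     ≡⟨ cong (a *_) (∑-one A) ⟩
      a * a                                  ∎
      where open ≡-Reasoning

    module Along (ξ : V n) where

      φ : V n → Scalar F
      φ = dot F ξ

      φ₂ : V n × V n → Scalar F
      φ₂ (x , y) = φ x +F φ y

      -- With Â(η) = Σ_{x ∈ A} χ(η·x) for a nontrivial additive character χ of F,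
      -- bias = Σ_{λ ≠ 0} |Â(λξ)|² and quadrupleBias s = Σ_{λ ≠ 0} |Â(λξ)|⁴ χ(λs).
      collisions : ℤ
      collisions = ⟨ count A φ , count A φ ⟩

      bias : ℤ
      bias = Q * collisions - a * a

      quadruples : Scalar F → ℤ
      quadruples s = ⟨ count pairs φ₂ , count pairs (λ p → φ₂ p +F s) ⟩

      quadrupleBias : Scalar F → ℤ
      quadrupleBias s = Q * quadruples s - (a * a) * (a * a)

      ∑-count-φ₂ : ∑ (allFin q) (count pairs φ₂) ≡ a * a
      ∑-count-φ₂ = trans (∑-count pairs φ₂) length-pairs

      ∑-count-shifted : ∀ s → ∑ (allFin q) (count pairs (λ p → φ₂ p +F s)) ≡ a * a
      ∑-count-shifted s = trans (∑-count pairs _) length-pairs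

      bias-nonNeg : 0ℤ ≤ bias
      bias-nonNeg = variance-nonNeg 0<Q (count A φ) (∑-count A φ)

      quadruples-0# : quadruples 0# ≡ ⟨ count pairs φ₂ , count pairs φ₂ ⟩
      quadruples-0# = ∑-cong (allFin q) (λ t → cong (count pairs φ₂ t *_)
        (∑-cong pairs (λ p → cong (λ z → ⟦ z ≟ t ⟧) (CommutativeRing.+-identityʳ ring (φ₂ p)))))

      quadrupleBias-0#-nonNeg : 0ℤ ≤ quadrupleBias 0#
      quadrupleBias-0#-nonNeg = subst (λ m → 0ℤ ≤ Q * m - (a * a) * (a * a)) (sym quadruples-0#)
        (variance-nonNeg 0<Q (count pairs φ₂) ∑-count-φ₂)

      count-φ₂-convolution : ∀ t → count pairs φ₂ t ≡ ⟨ count A φ , count A (λ y → t -F φ y) ⟩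
      count-φ₂-convolution t = begin
        ∑ pairs (λ p → ⟦ φ₂ p ≟ t ⟧)                     ≡⟨ ∑-cartesianProductWith _,_ A A _ ⟩
        ∑ A (λ x → ∑ A (λ y → ⟦ φ x +F φ y ≟ t ⟧))       ≡⟨ ∑-cong A (λ x → ∑-cong A (λ y → ⟦+≟⟧ (φ x) (φ y) t)) ⟩
        ∑ A (λ x → ∑ A (λ y → ⟦ φ x ≟ t -F φ y ⟧))       ≡⟨ sym (⟨count,count⟩ A A φ (λ y → t -F φ y)) ⟩
        ⟨ count A φ , count A (λ y → t -F φ y) ⟩         ∎
        where open ≡-Reasoning

      ⟨reflected,reflected⟩ : ∀ t → ⟨ count A (λ y → t -F φ y) , count A (λ y → t -F φ y) ⟩ ≡ collisions
      ⟨reflected,reflected⟩ t = trans (⟨count,count⟩ A A _ _)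
        (trans (∑-cong A (λ x → ∑-cong A (λ y → ⟦-≟-⟧ t (φ x) (φ y)))) (sym (⟨count,count⟩ A A φ φ)))

      ⟨shifted,shifted⟩ : ∀ s → ⟨ count pairs (λ p → φ₂ p +F s) , count pairs (λ p → φ₂ p +F s) ⟩
                                ≡ ⟨ count pairs φ₂ , count pairs φ₂ ⟩
      ⟨shifted,shifted⟩ s = trans (⟨count,count⟩ pairs pairs _ _)
        (trans (∑-cong pairs (λ p → ∑-cong pairs (λ p' → ⟦+≟+⟧-cancelʳ (φ₂ p) (φ₂ p') s)))
               (sym (⟨count,count⟩ pairs pairs φ₂ φ₂)))

      pairEnergy≤bias² : Q * ⟨ count pairs φ₂ , count pairs φ₂ ⟩ - (a * a) * (a * a) ≤ bias * bias
      pairEnergy≤bias² = ℤP.*-cancelˡ-≤-pos _ _ Q {{ℤ.positive 0<Q}} (begin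
        Q * (Q * ⟨ P , P ⟩ - (a * a) * (a * a))   ≡⟨ sym (⟨centred,centred⟩ P P ∑-count-φ₂ ∑-count-φ₂) ⟩
        ∑ (allFin q) (λ t → (Q * P t - a * a) * (Q * P t - a * a))
          ≤⟨ ∑-mono-≤ (allFin q) (λ {t} _ → centred-P²≤bias² t) ⟩
        ∑ (allFin q) (λ _ → bias * bias)          ≡⟨ ∑-const (allFin q) (bias * bias) ⟩
        Q * (bias * bias)                          ∎)
        where
        open ℤP.≤-Reasoning
        P = count pairs φ₂
        centred-P²≤bias² : ∀ t → (Q * P t - a * a) * (Q * P t - a * a) ≤ bias * bias
        centred-P²≤bias² t rewrite count-φ₂-convolution t =
          let (lower , upper) = covariance-bounded 0<Q (count A φ) (count A (λ y → t -F φ y))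
                                  (∑-count A φ) (∑-count A _) refl (⟨reflected,reflected⟩ t)
          in square-mono-≤ lower upper

      quadrupleBias-≥ : ∀ s → - (bias * bias) ≤ quadrupleBias s
      quadrupleBias-≥ s = ℤP.≤-trans (ℤP.neg-mono-≤ pairEnergy≤bias²)
        (proj₁ (covariance-bounded 0<Q (count pairs φ₂) (count pairs (λ p → φ₂ p +F s))
                  ∑-count-φ₂ (∑-count-shifted s) refl (⟨shifted,shifted⟩ s)))

      pointwise-bound : ∀ {c b} s → 0ℤ ≤ c → 0ℤ ≤ b → s ≡ 0# ⊎ c * bias ≤ b → 0ℤ ≤ c * quadrupleBias s + b * bias
      pointwise-bound s 0≤c 0≤b (inj₁ refl) =
        ℤP.+-mono-≤ (*-nonNeg 0≤c quadrupleBias-0#-nonNeg) (*-nonNeg 0≤b bias-nonNeg)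
      pointwise-bound {c} {b} s 0≤c 0≤b (inj₂ c*bias≤b) = subst (0ℤ ≤_) (regroup c (quadrupleBias s) bias b)
        (ℤP.+-mono-≤ (*-nonNeg 0≤c (ℤP.i≤j⇒0≤j-i (quadrupleBias-≥ s))) (*-nonNeg bias-nonNeg (ℤP.i≤j⇒0≤j-i c*bias≤b)))
        where regroup : ∀ c T e b → c * (T - - (e * e)) + e * (b - c * e) ≡ c * T + b * e
              regroup = solve-∀

  record In2A-2A {n : ℕ} (A : List (V n)) (u : V n) : Set where
    field
      x₁ x₂ x₃ x₄ : V n
      x₁∈A : x₁ ∈ A
      x₂∈A : x₂ ∈ A
      x₃∈A : x₃ ∈ A
      x₄∈A : x₄ ∈ A
      x₁+x₂≡x₃+x₄+u : x₁ +ⱽ x₂ ≡ x₃ +ⱽ x₄ +ⱽ u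

  module Spectrum (k : ℕ) (A : List (V (suc k))) (A-unique : Unique A) where

    open Energies A
    open Along

    2N a³ : ℤ
    2N = + 2 * N (suc k)
    a³ = a * a * a

    large? : Decidable (λ ξ → a³ < 2N * bias ξ)
    large? ξ = a³ ℤP.<? 2N * bias ξ

    spectrum : List (V (suc k))
    spectrum = filter large? (projective (suc k))

    0≤2N : 0ℤ ≤ 2N
    0≤2N = *-nonNeg {+ 2} {N (suc k)} (ℤ.+≤+ ℕ.z≤n) (ℤ.+≤+ ℕ.z≤n)

    0≤a³ : 0ℤ ≤ a³
    0≤a³ = *-nonNeg {a * a} {a} (square-nonNeg a) (ℤ.+≤+ ℕ.z≤n)

    ∑-collisions : ∑ (projective (suc k)) collisions ≡ a * (a * G k + N k)
    ∑-collisions = begin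
      ∑ (projective (suc k)) (λ ξ → collisions ξ)
        ≡⟨ ∑-cong (projective (suc k)) (λ ξ → ⟨count,count⟩ A A (dot F ξ) (dot F ξ)) ⟩
      ∑ (projective (suc k)) (λ ξ → ∑ A (λ x → ∑ A (λ y → ⟦ dot F ξ x ≟ dot F ξ y ⟧)))
        ≡⟨ ∑-comm (projective (suc k)) A _ ⟩
      ∑ A (λ x → ∑ (projective (suc k)) (λ ξ → ∑ A (λ y → ⟦ dot F ξ x ≟ dot F ξ y ⟧)))
        ≡⟨ ∑-cong A (λ x → trans (∑-comm (projective (suc k)) A _) (∑-cong A (λ y → ∑-projective-⟦dot≟dot⟧ k x y))) ⟩
      ∑ A (λ x → ∑ A (λ y → G k + ⟦ x ≟ⱽ y ⟧ * N k))
        ≡⟨ ∑-cong-∈ A (λ x∈A → trans (∑-+ A _ _) (cong₂ _+_ (∑-const A (G k)) (∑-⟦≟⟧-* _≟ⱽ_ (λ _ → N k) A-unique x∈A))) ⟩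
      ∑ A (λ _ → a * G k + N k)
        ≡⟨ ∑-const A _ ⟩
      a * (a * G k + N k) ∎
      where open ≡-Reasoning

    ∑-bias : ∑ (projective (suc k)) bias ≡ N (suc k) * a - a * a
    ∑-bias = begin
      ∑ (projective (suc k)) (λ ξ → Q * collisions ξ - a * a)
        ≡⟨ ∑-+ (projective (suc k)) _ _ ⟩
      ∑ (projective (suc k)) (λ ξ → Q * collisions ξ) + ∑ (projective (suc k)) (λ _ → - (a * a))
        ≡⟨ cong₂ _+_ (trans (∑-*ˡ (projective (suc k)) Q collisions) (cong (Q *_) ∑-collisions))
                     (trans (∑-const (projective (suc k)) _) (cong (_* - (a * a)) (G-recurrence k))) ⟩
      Q * (a * (a * G k + N k)) + (1ℤ + + q * G k) * - (a * a)
        ≡⟨ cong (λ Q → Q * (a * (a * G k + N k)) + (1ℤ + + q * G k) * - (a * a)) Q≡q ⟩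
      + q * (a * (a * G k + N k)) + (1ℤ + + q * G k) * - (a * a)
        ≡⟨ collect (+ q) a (G k) (N k) ⟩
      + q * N k * a - a * a
        ≡⟨ cong (λ n → n * a - a * a) (sym (N-suc k)) ⟩
      N (suc k) * a - a * a ∎
      where
      open ≡-Reasoning
      collect : ∀ q a g n → q * (a * (a * g + n)) + (1ℤ + q * g) * - (a * a) ≡ q * n * a - a * a
      collect = solve-∀

    length-spectrum : 0ℤ < a → + length spectrum * (a * a) ≤ + 2 * (N (suc k) * N (suc k))
    length-spectrum 0<a = ℤP.*-cancelʳ-≤-pos _ _ a {{ℤ.positive 0<a}} (begin
      + length spectrum * (a * a) * a
        ≡⟨ ℤP.*-assoc (+ length spectrum) (a * a) a ⟩
      + length spectrum * (a * a * a)
        ≡⟨ sym (∑-const spectrum a³) ⟩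
      ∑ spectrum (λ _ → a³)
        ≤⟨ ∑-mono-≤ spectrum (λ ξ∈ → ℤP.<⇒≤ (proj₂ (∈-filter⁻ large? {xs = projective (suc k)} ξ∈))) ⟩
      ∑ spectrum (λ ξ → 2N * bias ξ)
        ≤⟨ ∑-filter-≤ large? (projective (suc k)) (λ ξ → *-nonNeg 0≤2N (bias-nonNeg ξ)) ⟩
      ∑ (projective (suc k)) (λ ξ → 2N * bias ξ)
        ≡⟨ trans (∑-*ˡ (projective (suc k)) 2N bias) (cong (2N *_) ∑-bias) ⟩
      2N * (N (suc k) * a - a * a)
        ≤⟨ ℤP.*-monoˡ-≤-nonNeg 2N {{ℤ.nonNegative 0≤2N}}
             (ℤP.i-j≤i (N (suc k) * a) (a * a) {{ℤ.nonNegative (square-nonNeg a)}}) ⟩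
      2N * (N (suc k) * a)
        ≡⟨ regroup (N (suc k)) a ⟩
      + 2 * (N (suc k) * N (suc k)) * a ∎)
      where
      open ℤP.≤-Reasoning
      regroup : ∀ n a → + 2 * n * (n * a) ≡ + 2 * (n * n) * a
      regroup = solve-∀

    sum₂ : V (suc k) × V (suc k) → V (suc k)
    sum₂ (x , y) = x +ⱽ y

    module NoRepresentation (u : V (suc k))
      (none : ∀ {p p'} → p ∈ pairs → p' ∈ pairs → sum₂ p ≢ sum₂ p' +ⱽ u) where

      ∑-quadruples : ∑ (projective (suc k)) (λ ξ → quadruples ξ (dot F ξ u)) ≡ (a * a) * ((a * a) * G k)
      ∑-quadruples = begin
        ∑ (projective (suc k)) (λ ξ → quadruples ξ (dot F ξ u))
          ≡⟨ ∑-cong (projective (suc k)) (λ ξ → ⟨count,count⟩ pairs pairs _ _) ⟩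
        ∑ (projective (suc k)) (λ ξ → ∑ pairs (λ p → ∑ pairs (λ p' → ⟦ φ₂ ξ p ≟ φ₂ ξ p' +F dot F ξ u ⟧)))
          ≡⟨ ∑-comm (projective (suc k)) pairs _ ⟩
        ∑ pairs (λ p → ∑ (projective (suc k)) (λ ξ → ∑ pairs (λ p' → ⟦ φ₂ ξ p ≟ φ₂ ξ p' +F dot F ξ u ⟧)))
          ≡⟨ ∑-cong-∈ pairs (λ p∈ → trans (∑-comm (projective (suc k)) pairs _) (∑-cong-∈ pairs (λ p'∈ → G-only p∈ p'∈))) ⟩
        ∑ pairs (λ _ → ∑ pairs (λ _ → G k))
          ≡⟨ trans (∑-const pairs _) (cong₂ _*_ length-pairs (trans (∑-const pairs (G k)) (cong (_* G k) length-pairs))) ⟩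
        (a * a) * ((a * a) * G k) ∎
        where
        open ≡-Reasoning
        G-only : ∀ {p p'} → p ∈ pairs → p' ∈ pairs →
                 ∑ (projective (suc k)) (λ ξ → ⟦ φ₂ ξ p ≟ φ₂ ξ p' +F dot F ξ u ⟧) ≡ G k
        G-only {x₁ , x₂} {x₃ , x₄} p∈ p'∈ = begin
          ∑ (projective (suc k)) (λ ξ → ⟦ dot F ξ x₁ +F dot F ξ x₂ ≟ dot F ξ x₃ +F dot F ξ x₄ +F dot F ξ u ⟧)
            ≡⟨ ∑-cong (projective (suc k)) (λ ξ → sym (cong₂ (λ s t → ⟦ s ≟ t ⟧) (dot-+ⱽ ξ x₁ x₂)
                 (trans (dot-+ⱽ ξ (x₃ +ⱽ x₄) u) (cong (_+F dot F ξ u) (dot-+ⱽ ξ x₃ x₄))))) ⟩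
          ∑ (projective (suc k)) (λ ξ → ⟦ dot F ξ (x₁ +ⱽ x₂) ≟ dot F ξ (x₃ +ⱽ x₄ +ⱽ u) ⟧)
            ≡⟨ ∑-projective-⟦dot≟dot⟧ k (x₁ +ⱽ x₂) (x₃ +ⱽ x₄ +ⱽ u) ⟩
          G k + ⟦ x₁ +ⱽ x₂ ≟ⱽ x₃ +ⱽ x₄ +ⱽ u ⟧ * N k
            ≡⟨ cong (λ i → G k + i * N k) (⟦⟧-no (x₁ +ⱽ x₂ ≟ⱽ x₃ +ⱽ x₄ +ⱽ u) (none p∈ p'∈)) ⟩
          G k + 0ℤ
            ≡⟨ ℤP.+-identityʳ (G k) ⟩
          G k ∎

      ∑-quadrupleBias : ∑ (projective (suc k)) (λ ξ → quadrupleBias ξ (dot F ξ u)) ≡ - ((a * a) * (a * a))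
      ∑-quadrupleBias = begin
        ∑ (projective (suc k)) (λ ξ → Q * quadruples ξ (dot F ξ u) - (a * a) * (a * a))
          ≡⟨ ∑-+ (projective (suc k)) _ _ ⟩
        ∑ (projective (suc k)) (λ ξ → Q * quadruples ξ (dot F ξ u)) + ∑ (projective (suc k)) (λ _ → - ((a * a) * (a * a)))
          ≡⟨ cong₂ _+_ (trans (∑-*ˡ (projective (suc k)) Q _) (cong₂ _*_ Q≡q ∑-quadruples))
                       (trans (∑-const (projective (suc k)) _) (cong (_* - ((a * a) * (a * a))) (G-recurrence k))) ⟩
        + q * ((a * a) * ((a * a) * G k)) + (1ℤ + + q * G k) * - ((a * a) * (a * a))
          ≡⟨ cancel (+ q) (a * a) (G k) ⟩
        - ((a * a) * (a * a)) ∎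
        where
        open ≡-Reasoning
        cancel : ∀ q s g → q * (s * (s * g)) + (1ℤ + q * g) * - (s * s) ≡ - (s * s)
        cancel = solve-∀

      ∑-certificate : ∑ (projective (suc k)) (λ ξ → 2N * quadrupleBias ξ (dot F ξ u) + a³ * bias ξ)
                      ≡ - (a * a * a * a * (N (suc k) + a))
      ∑-certificate = begin
        ∑ (projective (suc k)) (λ ξ → 2N * quadrupleBias ξ (dot F ξ u) + a³ * bias ξ)
          ≡⟨ ∑-+ (projective (suc k)) _ _ ⟩
        ∑ (projective (suc k)) (λ ξ → 2N * quadrupleBias ξ (dot F ξ u)) + ∑ (projective (suc k)) (λ ξ → a³ * bias ξ)
          ≡⟨ cong₂ _+_ (trans (∑-*ˡ (projective (suc k)) 2N _) (cong (2N *_) ∑-quadrupleBias))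
                       (trans (∑-*ˡ (projective (suc k)) a³ bias) (cong (a³ *_) ∑-bias)) ⟩
        2N * - ((a * a) * (a * a)) + a³ * (N (suc k) * a - a * a)
          ≡⟨ collect (N (suc k)) a ⟩
        - (a * a * a * a * (N (suc k) + a)) ∎
        where
        open ≡-Reasoning
        collect : ∀ n a → + 2 * n * - ((a * a) * (a * a)) + a * a * a * (n * a - a * a) ≡ - (a * a * a * a * (n + a))
        collect = solve-∀

      certificate-nonNeg : (∀ {ξ} → ξ ∈ spectrum → dot F ξ u ≡ 0#) →
                           ∀ {ξ} → ξ ∈ projective (suc k) → 0ℤ ≤ 2N * quadrupleBias ξ (dot F ξ u) + a³ * bias ξ
      certificate-nonNeg u⊥spectrum {ξ} ξ∈ with large? ξ
      ... | yes large = pointwise-bound ξ (dot F ξ u) 0≤2N 0≤a³ (inj₁ (u⊥spectrum (∈-filter⁺ large? ξ∈ large)))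
      ... | no small  = pointwise-bound ξ (dot F ξ u) 0≤2N 0≤a³ (inj₂ (ℤP.≮⇒≥ small))

      impossible : 0ℤ < a → (∀ {ξ} → ξ ∈ spectrum → dot F ξ u ≡ 0#) → ⊥
      impossible 0<a u⊥spectrum = ℤP.<-irrefl refl (ℤP.≤-<-trans
        (subst (0ℤ ≤_) ∑-certificate (∑-nonNeg (projective (suc k)) (certificate-nonNeg u⊥spectrum)))
        (ℤP.neg-mono-< (*-pos (*-pos (*-pos (*-pos 0<a 0<a) 0<a) 0<a) (ℤP.+-mono-≤-< (ℤ.+≤+ ℕ.z≤n) 0<a))))

    orthogonal-to-spectrum⇒In2A-2A : 0ℤ < a → ∀ u → (∀ {ξ} → ξ ∈ spectrum → dot F ξ u ≡ 0#) → In2A-2A A u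
    orthogonal-to-spectrum⇒In2A-2A 0<a u u⊥spectrum
      with any? (λ p → any? (λ p' → sum₂ p ≟ⱽ sum₂ p' +ⱽ u) pairs) pairs
    ... | no none = ⊥-elim (NoRepresentation.impossible u (λ p∈ p'∈ eq → none (lose p∈ (lose p'∈ eq))) 0<a u⊥spectrum)
    ... | yes some with find some
    ...   | (x₁ , x₂) , p∈ , some' with find some'
    ...     | (x₃ , x₄) , p'∈ , eq = record
      { x₁∈A = proj₁ (∈-cartesianProduct⁻ A A p∈)
      ; x₂∈A = proj₂ (∈-cartesianProduct⁻ A A p∈)
      ; x₃∈A = proj₁ (∈-cartesianProduct⁻ A A p'∈)
      ; x₄∈A = proj₂ (∈-cartesianProduct⁻ A A p'∈)
      ; x₁+x₂≡x₃+x₄+u = eq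
      }

  bogolyubov : ∀ k (A : List (V (suc k))) → Unique A → 0 ℕ.< length A →
    ∃[ S ] + length S * (+ length A * + length A) ≤ + 2 * (N (suc k) * N (suc k))
         × (∀ u → (∀ {ξ} → ξ ∈ S → dot F ξ u ≡ 0#) → In2A-2A A u)
  bogolyubov k A A-unique 0<|A| =
    spectrum , length-spectrum 0<a , orthogonal-to-spectrum⇒In2A-2A 0<a
    where
    open Spectrum k A A-unique
    0<a = ℤ.+<+ 0<|A|


module Tensors (F : FiniteField) where

  open import Data.Nat.Tactic.RingSolver using () renaming (solve-∀ to ℕ-solve-∀)

  open VectorSpace F
  open CommutativeRing ring using (+-comm; +-assoc; distribˡ; distribʳ)
  open import Algebra.Properties.Ring (CommutativeRing.ring ring)
    using (x[y-z]≈xy-xz; -‿+-comm; ⁻¹-anti-homo-//; //-rightDividesʳ)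
  open import Tactic.RingSolver.NonReflective (fromCommutativeRing ring (λ _ → nothing)) using (solve; _⊜_; _⊕_)

  _⊗ᵀ_ : ∀ {n ns} → V n → Tensor F ns → Tensor F (n ∷ ns)
  (x ⊗ᵀ t) (i , is) = Vec.lookup x i * t is

  fibre : ∀ {n ns} → SubMultiset F (n ∷ ns) → V n → SubMultiset F ns
  fibre B' x w = B' (x , w)

  sumT-map : ∀ {n ns} (x : V n) (ws : List (Tuple F ns)) i is →
             sumT F (map (x ,_) ws) (i , is) ≡ Vec.lookup x i * sumT F ws is
  sumT-map x []       i is = sym (CommutativeRing.zeroʳ ring (Vec.lookup x i))
  sumT-map x (w ∷ ws) i is = trans (cong (_+_ (Vec.lookup x i * tensor F w is)) (sumT-map x ws i is))
                                   (sym (distribˡ (Vec.lookup x i) (tensor F w is) (sumT F ws is)))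

  sumT-++ : ∀ {ns} (ws ws' : List (Tuple F ns)) is → sumT F (ws ++ ws') is ≡ sumT F ws is + sumT F ws' is
  sumT-++ []       ws' is = sym (CommutativeRing.+-identityˡ ring (sumT F ws' is))
  sumT-++ (w ∷ ws) ws' is = trans (cong (_+_ (tensor F w is)) (sumT-++ ws ws' is))
                                  (sym (+-assoc (tensor F w is) (sumT F ws is) (sumT F ws' is)))

  module _ {ns : List ℕ} (B' : SubMultiset F ns) where

    InSumDiff-cong : ∀ {k} {s t : Tensor F ns} → (∀ is → s is ≡ t is) → InSumDiff F ns B' k s → InSumDiff F ns B' k t
    InSumDiff-cong s≗t (xs , ys , xs∈ , ys∈ , |xs| , |ys| , s≗) =
      xs , ys , xs∈ , ys∈ , |xs| , |ys| , λ is → trans (sym (s≗t is)) (s≗ is)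

    InSumDiff-+ : ∀ {k k'} {s t : Tensor F ns} → InSumDiff F ns B' k s → InSumDiff F ns B' k' t →
                  InSumDiff F ns B' (k ℕ.+ k') (_+T_ F s t)
    InSumDiff-+ (xs , ys , xs∈ , ys∈ , |xs| , |ys| , s≗) (xs' , ys' , xs'∈ , ys'∈ , |xs'| , |ys'| , t≗) =
      xs ++ xs' , ys ++ ys' , AllP.++⁺ xs∈ xs'∈ , AllP.++⁺ ys∈ ys'∈ ,
      subst (ℕ._≤ _) (sym (ListP.length-++ xs)) (ℕP.+-mono-≤ |xs| |xs'|) ,
      subst (ℕ._≤ _) (sym (ListP.length-++ ys)) (ℕP.+-mono-≤ |ys| |ys'|) ,
      λ is → trans (cong₂ _+_ (s≗ is) (t≗ is)) (trans (interchange _ _ _ _)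
               (sym (cong₂ _-_ (sumT-++ xs xs' is) (sumT-++ ys ys' is))))
      where
      interchange : ∀ a b c d → (a - b) + (c - d) ≡ (a + c) - (b + d)
      interchange a b c d = trans (solve 4 (λ a b c d → ((a ⊕ b) ⊕ (c ⊕ d)) ⊜ ((a ⊕ c) ⊕ (b ⊕ d))) refl a (- b) c (- d))
                                  (cong (_+_ (a + c)) (-‿+-comm b d))

    InSumDiff-neg : ∀ {k} {t : Tensor F ns} → InSumDiff F ns B' k t → InSumDiff F ns B' k (λ is → - t is)
    InSumDiff-neg (xs , ys , xs∈ , ys∈ , |xs| , |ys| , t≗) =
      ys , xs , ys∈ , xs∈ , |ys| , |xs| , λ is → trans (cong -_ (t≗ is)) (⁻¹-anti-homo-// (sumT F xs is) (sumT F ys is))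

  InSumDiff-⊗ : ∀ {n ns k} (B' : SubMultiset F (n ∷ ns)) (x : V n) {t : Tensor F ns} →
                InSumDiff F ns (fibre B' x) k t → InSumDiff F (n ∷ ns) B' k (x ⊗ᵀ t)
  InSumDiff-⊗ B' x {t} (xs , ys , xs∈ , ys∈ , |xs| , |ys| , t≗) =
    map (x ,_) xs , map (x ,_) ys , AllP.map⁺ xs∈ , AllP.map⁺ ys∈ ,
    subst (ℕ._≤ _) (sym (ListP.length-map _ xs)) |xs| ,
    subst (ℕ._≤ _) (sym (ListP.length-map _ ys)) |ys| ,
    λ { (i , is) → let c = Vec.lookup x i in begin
      c * t is                                    ≡⟨ cong (c *_) (t≗ is) ⟩
      c * (sumT F xs is - sumT F ys is)            ≡⟨ x[y-z]≈xy-xz c (sumT F xs is) (sumT F ys is) ⟩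
      c * sumT F xs is - c * sumT F ys is          ≡⟨ sym (cong₂ _-_ (sumT-map x xs i is) (sumT-map x ys i is)) ⟩
      sumT F (map (x ,_) xs) (i , is) - sumT F (map (x ,_) ys) (i , is) ∎ }
    where open ≡-Reasoning

  private
    coordinate-identity : ∀ {a b c e u} T → a + b ≡ c + e + u → a * T + b * T + (- (c * T) + - (e * T)) ≡ u * T
    coordinate-identity {a} {b} {c} {e} {u} T a+b≡c+e+u = begin
      a * T + b * T + (- (c * T) + - (e * T))  ≡⟨ cong₂ _+_ (sym (distribʳ T a b)) (-‿+-comm (c * T) (e * T)) ⟩
      (a + b) * T - (c * T + e * T)            ≡⟨ cong₂ (λ s r → s * T - r) a+b≡c+e+u (sym (distribʳ T c e)) ⟩
      (c + e + u) * T - (c + e) * T            ≡⟨ cong (_- (c + e) * T) (trans (distribʳ T (c + e) u) (+-comm _ (u * T))) ⟩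
      (u * T + (c + e) * T) - (c + e) * T      ≡⟨ //-rightDividesʳ ((c + e) * T) (u * T) ⟩
      u * T                                    ∎
      where open ≡-Reasoning

  InSumDiff-u⊗ : ∀ {n ns k} (B' : SubMultiset F (n ∷ ns)) {u x₁ x₂ x₃ x₄ : V n} → x₁ +ⱽ x₂ ≡ x₃ +ⱽ x₄ +ⱽ u →
                 (w : Tuple F ns) →
                 InSumDiff F ns (fibre B' x₁) k (tensor F w) → InSumDiff F ns (fibre B' x₂) k (tensor F w) →
                 InSumDiff F ns (fibre B' x₃) k (tensor F w) → InSumDiff F ns (fibre B' x₄) k (tensor F w) →
                 InSumDiff F (n ∷ ns) B' (4 ℕ.* k) (tensor F (u , w))
  InSumDiff-u⊗ {k = k} B' {u} {x₁} {x₂} {x₃} {x₄} x₁+x₂≡x₃+x₄+u w h₁ h₂ h₃ h₄ =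
    InSumDiff-cong B' (λ { (i , is) → coordinate-identity (tensor F w is) (at i) })
      (subst (λ m → InSumDiff F _ B' m combination) (four-times k)
        (InSumDiff-+ B' (InSumDiff-+ B' (InSumDiff-⊗ B' x₁ h₁) (InSumDiff-⊗ B' x₂ h₂))
                        (InSumDiff-+ B' (InSumDiff-neg B' (InSumDiff-⊗ B' x₃ h₃)) (InSumDiff-neg B' (InSumDiff-⊗ B' x₄ h₄)))))
    where
    t = tensor F w
    combination : Tensor F _
    combination = _+T_ F (_+T_ F (x₁ ⊗ᵀ t) (x₂ ⊗ᵀ t)) (_+T_ F (λ is → - (x₃ ⊗ᵀ t) is) (λ is → - (x₄ ⊗ᵀ t) is))
    at : ∀ i → Vec.lookup x₁ i + Vec.lookup x₂ i ≡ Vec.lookup x₃ i + Vec.lookup x₄ i + Vec.lookup u i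
    at i = begin
      Vec.lookup x₁ i + Vec.lookup x₂ i                      ≡⟨ sym (VecP.lookup-zipWith _+_ i x₁ x₂) ⟩
      Vec.lookup (x₁ +ⱽ x₂) i                                ≡⟨ cong (λ v → Vec.lookup v i) x₁+x₂≡x₃+x₄+u ⟩
      Vec.lookup (x₃ +ⱽ x₄ +ⱽ u) i                           ≡⟨ VecP.lookup-zipWith _+_ i (x₃ +ⱽ x₄) u ⟩
      Vec.lookup (x₃ +ⱽ x₄) i + Vec.lookup u i               ≡⟨ cong (_+ Vec.lookup u i) (VecP.lookup-zipWith _+_ i x₃ x₄) ⟩
      Vec.lookup x₃ i + Vec.lookup x₄ i + Vec.lookup u i     ∎
      where open ≡-Reasoning
    four-times : ∀ k → k ℕ.+ k ℕ.+ (k ℕ.+ k) ≡ 4 ℕ.* k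
    four-times = ℕ-solve-∀


module Systems (F : FiniteField) where

  open VectorSpace F using (V; 0#)

  -- the same shape as _∈S_ in Defs, so that membership in a kernel and in a Subspace agree definitionally
  Orthogonal : ∀ {n m} → V n → Vec (V n) m → Set
  Orthogonal u rows = Vec.foldr (λ _ → Set) (λ row P → (dot F row u ≡ 0#) × P) ⊤ rows

  record Kernel (Bound : ℕ → Set) (n : ℕ) : Set where
    constructor kernel
    field
      m     : ℕ
      bound : Bound m
      rows  : Vec (V n) m

  _∈ᴷ_ : ∀ {Bound n} → V n → Kernel Bound n → Set
  u ∈ᴷ U = Orthogonal u (Kernel.rows U)

  -- An l-system in which "codimension at most l" is replaced by an arbitrary predicate on the number of
  -- functionals; the induction uses integral bounds m · p² ≤ K instead of rational ones.
  SystemWith : (ℕ → Set) → List ℕ → Set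
  SystemWith Bound []       = ⊤
  SystemWith Bound (n ∷ ns) = Σ (Kernel Bound n) λ U → (u : V n) → u ∈ᴷ U → SystemWith Bound ns

  InSystemWith : ∀ {Bound ns} → SystemWith Bound ns → Tuple F ns → Set
  InSystemWith {ns = []}     tt         tt       = ⊤
  InSystemWith {ns = n ∷ ns} (U , rest) (u , us) = Σ (u ∈ᴷ U) λ u∈U → InSystemWith (rest u u∈U) us

  kernelOf : ∀ {Bound n} (ξs : List (V n)) → Bound (length ξs) → Kernel Bound n
  kernelOf ξs bound = kernel (length ξs) bound (Vec.fromList ξs)

  Orthogonal-fromList⁻ : ∀ {n} (ξs : List (V n)) {u} → Orthogonal u (Vec.fromList ξs) → ∀ {ξ} → ξ ∈ ξs → dot F ξ u ≡ 0#
  Orthogonal-fromList⁻ (_ ∷ _)  (ξ⊥u , _)  (here refl) = ξ⊥u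
  Orthogonal-fromList⁻ (_ ∷ ξs) (_ , ⊥ξs) (there ξ∈) = Orthogonal-fromList⁻ ξs ⊥ξs ξ∈

  Orthogonal-++⁻ : ∀ {n m₁ m₂} (u : V n) (rows₁ : Vec (V n) m₁) (rows₂ : Vec (V n) m₂) →
                   Orthogonal u (rows₁ Vec.++ rows₂) → Orthogonal u rows₁ × Orthogonal u rows₂
  Orthogonal-++⁻ u []             rows₂ ⊥₂           = tt , ⊥₂
  Orthogonal-++⁻ u (ξ ∷ rows₁) rows₂ (ξ⊥u , ⊥₁₂) =
    let (⊥₁ , ⊥₂) = Orthogonal-++⁻ u rows₁ rows₂ ⊥₁₂ in (ξ⊥u , ⊥₁) , ⊥₂

  module _ {B₁ B₂ B : ℕ → Set} (combine : ∀ {m₁ m₂} → B₁ m₁ → B₂ m₂ → B (m₁ ℕ.+ m₂)) where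

    Kernel-∩ : ∀ {n} → Kernel B₁ n → Kernel B₂ n → Kernel B n
    Kernel-∩ (kernel m₁ b₁ rows₁) (kernel m₂ b₂ rows₂) = kernel (m₁ ℕ.+ m₂) (combine b₁ b₂) (rows₁ Vec.++ rows₂)

    SystemWith-∩ : ∀ ns → SystemWith B₁ ns → SystemWith B₂ ns → SystemWith B ns
    SystemWith-∩ []       tt           tt           = tt
    SystemWith-∩ (n ∷ ns) (U₁ , rest₁) (U₂ , rest₂) = Kernel-∩ U₁ U₂ , λ u u∈U →
      let (u∈U₁ , u∈U₂) = Orthogonal-++⁻ u (Kernel.rows U₁) (Kernel.rows U₂) u∈U
      in SystemWith-∩ ns (rest₁ u u∈U₁) (rest₂ u u∈U₂)

    InSystemWith-∩⁻ : ∀ ns (S₁ : SystemWith B₁ ns) (S₂ : SystemWith B₂ ns) us →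
                      InSystemWith (SystemWith-∩ ns S₁ S₂) us → InSystemWith S₁ us × InSystemWith S₂ us
    InSystemWith-∩⁻ []       tt           tt           tt       tt            = tt , tt
    InSystemWith-∩⁻ (n ∷ ns) (U₁ , rest₁) (U₂ , rest₂) (u , us) (u∈U , inS) =
      let (u∈U₁ , u∈U₂) = Orthogonal-++⁻ u (Kernel.rows U₁) (Kernel.rows U₂) u∈U
          (in₁ , in₂)   = InSystemWith-∩⁻ ns (rest₁ u u∈U₁) (rest₂ u u∈U₂) us inS
      in (u∈U₁ , in₁) , (u∈U₂ , in₂)

  module _ {Bound : ℕ → Set} {l : ℚ} (≤l : ∀ {m} → Bound m → ℕtoℚ m ℚ.≤ l) where

    toSystem : ∀ ns → SystemWith Bound ns → System F l ns
    toSystem []       tt                          = tt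
    toSystem (n ∷ ns) (kernel m bound rows , rest) = subspace m (≤l bound) rows , λ u u∈U → toSystem ns (rest u u∈U)

    InSystem-toSystem⁻ : ∀ ns (S : SystemWith Bound ns) us → InSystem F (toSystem ns S) us → InSystemWith S us
    InSystem-toSystem⁻ []       tt                     tt       tt            = tt
    InSystem-toSystem⁻ (n ∷ ns) (kernel m b rows , rest) (u , us) (u∈U , inS) =
      u∈U , InSystem-toSystem⁻ ns (rest u u∈U) us inS


module DenseInduction (F : FiniteField) where

  open import Data.Integer using (_+_; _*_; -_; _-_; _≤_; _<_)

  open VectorSpace F hiding (_+_; _*_; -_; _-_)
  open Bogolyubov F using (bogolyubov; In2A-2A)
  open Tensors F using (fibre; InSumDiff-u⊗)
  open Systems F
  open import Algebra.Properties.Ring (CommutativeRing.ring ring) using (//-rightDividesʳ)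

  +size𝓑-∷ : ∀ n ns → + size𝓑 F (n ∷ ns) ≡ N n * + size𝓑 F ns
  +size𝓑-∷ n ns = begin
    + size𝓑 F (n ∷ ns)                                      ≡⟨ sym (∑-one (allTuples F (n ∷ ns))) ⟩
    ∑ (allTuples F (n ∷ ns)) (λ _ → 1ℤ)                      ≡⟨ ∑-cartesianProductWith _,_ (allVectors F n) (allTuples F ns) _ ⟩
    ∑ (allVectors F n) (λ _ → ∑ (allTuples F ns) (λ _ → 1ℤ)) ≡⟨ ∑-const (allVectors F n) _ ⟩
    N n * ∑ (allTuples F ns) (λ _ → 1ℤ)                      ≡⟨ cong (N n *_) (∑-one (allTuples F ns)) ⟩
    N n * + size𝓑 F ns                                      ∎
    where open ≡-Reasoning

  +size𝓑'-∷ : ∀ n ns (B' : SubMultiset F (n ∷ ns)) →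
              + size𝓑' F (n ∷ ns) B' ≡ ∑ (allVectors F n) (λ x → + size𝓑' F ns (fibre B' x))
  +size𝓑'-∷ n ns B' = begin
    + size𝓑' F (n ∷ ns) B'
      ≡⟨ sym (∑-indicator _ (allTuples F (n ∷ ns))) ⟩
    ∑ (allTuples F (n ∷ ns)) _
      ≡⟨ ∑-cartesianProductWith _,_ (allVectors F n) (allTuples F ns) _ ⟩
    ∑ (allVectors F n) (λ x → ∑ (allTuples F ns) _)
      ≡⟨ ∑-cong (allVectors F n) (λ x → ∑-indicator _ (allTuples F ns)) ⟩
    ∑ (allVectors F n) (λ x → + size𝓑' F ns (fibre B' x)) ∎
    where open ≡-Reasoning

  +size𝓑'≤+size𝓑 : ∀ ns (B' : SubMultiset F ns) → + size𝓑' F ns B' ≤ + size𝓑 F ns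
  +size𝓑'≤+size𝓑 ns B' = ℤ.+≤+ (ListP.length-filter _ (allTuples F ns))

  0<size𝓑 : ∀ ns → 0ℤ < + size𝓑 F ns
  0<size𝓑 []       = ℤ.+<+ (ℕ.s≤s ℕ.z≤n)
  0<size𝓑 (n ∷ ns) = subst (0ℤ <_) (sym (+size𝓑-∷ n ns)) (*-pos (0<N n) (0<size𝓑 ns))

  -- δ = p / r, and x is dense when its fibre has density at least δ/2
  module DenseFibres (n : ℕ) (ns : List ℕ) (p r : ℤ) (B' : SubMultiset F (n ∷ ns)) where

    maxWeight : ℤ
    maxWeight = + size𝓑 F ns

    weight : V n → ℤ
    weight x = + size𝓑' F ns (fibre B' x)

    dense? : Decidable (λ x → p * maxWeight ≤ + 2 * r * weight x)
    dense? x = p * maxWeight ℤP.≤? + 2 * r * weight x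

    A : List (V n)
    A = filter dense? (allVectors F n)

    markov : 0ℤ ≤ p → 0ℤ ≤ r → + 2 * r * ∑ (allVectors F n) weight ≤ + 2 * r * maxWeight * + length A + p * maxWeight * N n
    markov 0≤p 0≤r = begin
      + 2 * r * ∑ (allVectors F n) weight
        ≡⟨ sym (∑-*ˡ (allVectors F n) (+ 2 * r) weight) ⟩
      ∑ (allVectors F n) (λ x → + 2 * r * weight x)
        ≤⟨ ∑-mono-≤ (allVectors F n) (λ {x} _ → pointwise x) ⟩
      ∑ (allVectors F n) (λ x → + 2 * r * maxWeight * ⟦ dense? x ⟧ + p * maxWeight)
        ≡⟨ ∑-+ (allVectors F n) _ _ ⟩
      ∑ (allVectors F n) (λ x → + 2 * r * maxWeight * ⟦ dense? x ⟧) + ∑ (allVectors F n) (λ _ → p * maxWeight)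
        ≡⟨ cong₂ _+_ (trans (∑-*ˡ (allVectors F n) (+ 2 * r * maxWeight) _)
                            (cong (+ 2 * r * maxWeight *_) (∑-indicator dense? (allVectors F n))))
                     (trans (∑-const (allVectors F n) (p * maxWeight)) (ℤP.*-comm (N n) (p * maxWeight))) ⟩
      + 2 * r * maxWeight * + length A + p * maxWeight * N n ∎
      where
      open ℤP.≤-Reasoning
      0≤2r : 0ℤ ≤ + 2 * r
      0≤2r = *-nonNeg {+ 2} {r} (ℤ.+≤+ ℕ.z≤n) 0≤r
      0≤p*maxWeight : 0ℤ ≤ p * maxWeight
      0≤p*maxWeight = *-nonNeg {p} {maxWeight} 0≤p (ℤ.+≤+ ℕ.z≤n)
      pointwise : ∀ x → + 2 * r * weight x ≤ + 2 * r * maxWeight * ⟦ dense? x ⟧ + p * maxWeight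
      pointwise x with dense? x
      ... | yes _ = ℤP.≤-trans (ℤP.*-monoˡ-≤-nonNeg (+ 2 * r) {{ℤ.nonNegative 0≤2r}} (+size𝓑'≤+size𝓑 ns (fibre B' x)))
                      (ℤP.≤-trans (ℤP.≤-reflexive (sym (ℤP.*-identityʳ (+ 2 * r * maxWeight))))
                                  (ℤP.i≤i+j (+ 2 * r * maxWeight * 1ℤ) (p * maxWeight) {{ℤ.nonNegative 0≤p*maxWeight}}))
      ... | no sparse = ℤP.≤-trans (ℤP.<⇒≤ (ℤP.≰⇒> sparse))
                          (ℤP.≤-trans (ℤP.≤-reflexive (sym (ℤP.+-identityˡ (p * maxWeight))))
                                      (ℤP.+-monoˡ-≤ (p * maxWeight) (ℤP.≤-reflexive (sym (ℤP.*-zeroʳ (+ 2 * r * maxWeight))))))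

    many-dense-fibres : 0ℤ < p → 0ℤ ≤ r → p * + size𝓑 F (n ∷ ns) ≤ r * + size𝓑' F (n ∷ ns) B' →
                    p * N n ≤ + 2 * r * + length A
    many-dense-fibres 0<p 0≤r hyp = ℤP.*-cancelʳ-≤-pos _ _ maxWeight {{ℤ.positive (0<size𝓑 ns)}} (halve (begin
      p * N n * maxWeight + p * N n * maxWeight
        ≡⟨ double p (N n) maxWeight ⟩
      + 2 * (p * (N n * maxWeight))
        ≤⟨ ℤP.*-monoˡ-≤-nonNeg (+ 2) (subst₂ (λ s s' → p * s ≤ r * s') (+size𝓑-∷ n ns) (+size𝓑'-∷ n ns B') hyp) ⟩
      + 2 * (r * ∑ (allVectors F n) weight)
        ≡⟨ sym (ℤP.*-assoc (+ 2) r _) ⟩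
      + 2 * r * ∑ (allVectors F n) weight
        ≤⟨ markov (ℤP.<⇒≤ 0<p) 0≤r ⟩
      + 2 * r * maxWeight * + length A + p * maxWeight * N n
        ≡⟨ rearrange r maxWeight (+ length A) p (N n) ⟩
      + 2 * r * + length A * maxWeight + p * N n * maxWeight ∎))
      where
      open ℤP.≤-Reasoning
      double : ∀ p n m → p * n * m + p * n * m ≡ + 2 * (p * (n * m))
      double = solve-∀
      rearrange : ∀ r m a p n → + 2 * r * m * a + p * m * n ≡ + 2 * r * a * m + p * n * m
      rearrange = solve-∀
      halve : ∀ {x z} → x + x ≤ z + x → x ≤ z
      halve {x} {z} le = ℤP.0≤i-j⇒j≤i (subst (0ℤ ≤_) (difference z x) (ℤP.i≤j⇒0≤j-i le))
        where difference : ∀ z x → (z + x) - (x + x) ≡ z - x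
              difference = solve-∀

  codimension-bound : ∀ {m p r a n} → 0ℤ < p → 0ℤ < n →
                      + m * (a * a) ≤ + 2 * (n * n) → p * n ≤ + 2 * r * a → + m * (p * p) ≤ + 8 * (r * r)
  codimension-bound {m} {p} {r} {a} {n} 0<p 0<n small-spectrum dense =
    ℤP.*-cancelʳ-≤-pos _ _ (n * n) {{ℤ.positive (*-pos 0<n 0<n)}} (begin
      + m * (p * p) * (n * n)       ≡⟨ regroup₁ (+ m) p n ⟩
      + m * ((p * n) * (p * n))     ≤⟨ ℤP.*-monoˡ-≤-nonNeg (+ m) (square-mono-≤ -2ra≤pn dense) ⟩
      + m * ((+ 2 * r * a) * (+ 2 * r * a)) ≡⟨ regroup₂ (+ m) r a ⟩
      + 4 * (r * r) * (+ m * (a * a))  ≤⟨ ℤP.*-monoˡ-≤-nonNeg (+ 4 * (r * r)) {{ℤ.nonNegative 0≤4r²}} small-spectrum ⟩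
      + 4 * (r * r) * (+ 2 * (n * n))  ≡⟨ regroup₃ r n ⟩
      + 8 * (r * r) * (n * n) ∎)
    where
    open ℤP.≤-Reasoning
    0≤pn : 0ℤ ≤ p * n
    0≤pn = *-nonNeg (ℤP.<⇒≤ 0<p) (ℤP.<⇒≤ 0<n)
    0≤4r² : 0ℤ ≤ + 4 * (r * r)
    0≤4r² = *-nonNeg {+ 4} (ℤ.+≤+ ℕ.z≤n) (square-nonNeg r)
    -2ra≤pn : - (+ 2 * r * a) ≤ p * n
    -2ra≤pn = ℤP.≤-trans (ℤP.neg-mono-≤ (ℤP.≤-trans 0≤pn dense)) 0≤pn
    regroup₁ : ∀ m p n → m * (p * p) * (n * n) ≡ m * ((p * n) * (p * n))
    regroup₁ = solve-∀
    regroup₂ : ∀ m r a → m * ((+ 2 * r * a) * (+ 2 * r * a)) ≡ + 4 * (r * r) * (m * (a * a))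
    regroup₂ = solve-∀
    regroup₃ : ∀ r n → + 4 * (r * r) * (+ 2 * (n * n)) ≡ + 8 * (r * r) * (n * n)
    regroup₃ = solve-∀

  record Bound (pp K : ℤ) (m : ℕ) : Set where
    constructor bound
    field
      m*pp≤K : + m * pp ≤ K

  Bound-+ : ∀ {pp K₁ K₂ m₁ m₂} → Bound pp K₁ m₁ → Bound pp K₂ m₂ → Bound pp (K₁ + K₂) (m₁ ℕ.+ m₂)
  Bound-+ {pp} {m₁ = m₁} {m₂} (bound b₁) (bound b₂) = bound
    (subst (_≤ _) (sym (trans (cong (_* pp) (ℤP.pos-+ m₁ m₂)) (ℤP.*-distribʳ-+ pp (+ m₁) (+ m₂)))) (ℤP.+-mono-≤ b₁ b₂))

  Codim : ℤ → ℤ → ℕ → ℕ → Set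
  Codim p r d = Bound (p * p) (+ (16 ^ d) * (r * r))

  0<size𝓑'⇒T : (B' : SubMultiset F []) → 0 ℕ.< size𝓑' F [] B' → T (B' tt)
  0<size𝓑'⇒T B' 0<size' with B' tt
  ... | true  = tt
  ... | false = ⊥-elim (ℕP.<-irrefl refl 0<size')

  InSumDiff-base : ∀ {p r} → 0ℤ < p → (B' : SubMultiset F []) → p * + size𝓑 F [] ≤ r * + size𝓑' F [] B' →
                   InSumDiff F [] B' 1 (tensor F tt)
  InSumDiff-base {p} {r} 0<p B' hyp =
    tt ∷ [] , [] , 0<size𝓑'⇒T B' (0<r*s⇒0<s r (size𝓑' F [] B') 0<r*size') ∷ [] , [] , ℕ.s≤s ℕ.z≤n , ℕ.z≤n ,
    λ { tt → sym (//-rightDividesʳ 0# 1#) }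
    where
    0<r*size' : 0ℤ < r * + size𝓑' F [] B'
    0<r*size' = ℤP.<-≤-trans (subst (0ℤ <_) (sym (ℤP.*-identityʳ p)) 0<p) hyp

  private
    Bound-+-into : ∀ {pp K K'} → K + (K + (K + K)) ≡ K' →
                   ∀ {m₁ m₂} → Bound pp K m₁ → Bound pp (K + (K + K)) m₂ → Bound pp K' (m₁ ℕ.+ m₂)
    Bound-+-into {pp} {K} eq {m₁} {m₂} b₁ b₂ = subst (λ K → Bound pp K (m₁ ℕ.+ m₂)) eq (Bound-+ b₁ b₂)

  SystemWith-∩₄ : ∀ {pp K K'} ns → K + (K + (K + K)) ≡ K' →
                  (S₁ S₂ S₃ S₄ : SystemWith (Bound pp K) ns) → SystemWith (Bound pp K') ns
  SystemWith-∩₄ ns eq S₁ S₂ S₃ S₄ =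
    SystemWith-∩ (Bound-+-into eq) ns S₁ (SystemWith-∩ Bound-+ ns S₂ (SystemWith-∩ Bound-+ ns S₃ S₄))

  InSystemWith-∩₄⁻ : ∀ {pp K K'} ns (eq : K + (K + (K + K)) ≡ K') (S₁ S₂ S₃ S₄ : SystemWith (Bound pp K) ns) us →
                     InSystemWith (SystemWith-∩₄ ns eq S₁ S₂ S₃ S₄) us →
                     InSystemWith S₁ us × InSystemWith S₂ us × InSystemWith S₃ us × InSystemWith S₄ us
  InSystemWith-∩₄⁻ ns eq S₁ S₂ S₃ S₄ us in∩ =
    let (in₁ , in₂₃₄) = InSystemWith-∩⁻ (Bound-+-into eq) ns S₁ _ us in∩
        (in₂ , in₃₄)  = InSystemWith-∩⁻ Bound-+ ns S₂ _ us in₂₃₄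
        (in₃ , in₄)   = InSystemWith-∩⁻ Bound-+ ns S₃ S₄ us in₃₄
    in in₁ , in₂ , in₃ , in₄

  four-fibres : ∀ d r → let K = + (16 ^ d) * (+ 2 * r * (+ 2 * r)) in K + (K + (K + K)) ≡ + (16 ^ suc d) * (r * r)
  four-fibres d r = trans (regroup (+ (16 ^ d)) r) (cong (_* (r * r)) (sym (ℤP.pos-* 16 (16 ^ d))))
    where regroup : ∀ x r → let K = x * (+ 2 * r * (+ 2 * r)) in K + (K + (K + K)) ≡ + 16 * x * (r * r)
          regroup = solve-∀

  8≤16^suc : ∀ d r → + 8 * (r * r) ≤ + (16 ^ suc d) * (r * r)
  8≤16^suc d r = ℤP.*-monoʳ-≤-nonNeg (r * r) {{ℤ.nonNegative (square-nonNeg r)}}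
    (ℤ.+≤+ (ℕP.≤-trans (ℕP.m≤m+n 8 8) (ℕP.m≤m*n 16 (16 ^ d) {{ℕP.m^n≢0 16 d}})))

  sumDiff-system : ∀ ns → All (1 ℕ.≤_) ns → ∀ {p r} → 0ℤ < p → 0ℤ < r → (B' : SubMultiset F ns) →
    p * + size𝓑 F ns ≤ r * + size𝓑' F ns B' →
    Σ (SystemWith (Codim p r (length ns)) ns) λ S →
      ∀ us → InSystemWith S us → InSumDiff F ns B' (4 ^ length ns) (tensor F us)
  sumDiff-system []            []          {p} {r} 0<p 0<r B' hyp = tt , λ { tt tt → InSumDiff-base {p} {r} 0<p B' hyp }
  sumDiff-system (suc k ∷ ns)  (_ ∷ ns≥1) {p} {r} 0<p 0<r B' hyp = (U , rest) , in-sumDiff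
    where
    open DenseFibres (suc k) ns p r B'
    d = length ns
    density : p * N (suc k) ≤ + 2 * r * + length A
    density = many-dense-fibres 0<p (ℤP.<⇒≤ 0<r) hyp
    spectrum = bogolyubov k A (filter⁺ dense? (allVectors-unique (suc k)))
                 (0<r*s⇒0<s (+ 2 * r) (length A) (ℤP.<-≤-trans (*-pos 0<p (0<N (suc k))) density))
    U : Kernel (Codim p r (suc d)) (suc k)
    U = kernelOf (proj₁ spectrum) (bound (ℤP.≤-trans
          (codimension-bound {length (proj₁ spectrum)} {p} {r} {+ length A} {N (suc k)} 0<p (0<N (suc k))
             (proj₁ (proj₂ spectrum)) density)
          (8≤16^suc d r)))
    representation : ∀ u → u ∈ᴷ U → In2A-2A A u
    representation u u∈U = proj₂ (proj₂ spectrum) u (Orthogonal-fromList⁻ (proj₁ spectrum) u∈U)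
    fibre-system : ∀ {x} → x ∈ A → Σ (SystemWith (Codim p (+ 2 * r) d) ns) λ S →
                   ∀ us → InSystemWith S us → InSumDiff F ns (fibre B' x) (4 ^ d) (tensor F us)
    fibre-system x∈A = sumDiff-system ns ns≥1 0<p (*-pos {+ 2} (ℤ.+<+ (ℕ.s≤s ℕ.z≤n)) 0<r) (fibre B' _)
                         (proj₂ (∈-filter⁻ dense? {xs = allVectors F (suc k)} x∈A))
    rest : ∀ u → u ∈ᴷ U → SystemWith (Codim p r (suc d)) ns
    rest u u∈U = SystemWith-∩₄ ns (four-fibres d r)
      (proj₁ (fibre-system x₁∈A)) (proj₁ (fibre-system x₂∈A)) (proj₁ (fibre-system x₃∈A)) (proj₁ (fibre-system x₄∈A))
      where open In2A-2A (representation u u∈U)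
    in-sumDiff : ∀ us → InSystemWith (U , rest) us → InSumDiff F (suc k ∷ ns) B' (4 ^ suc d) (tensor F us)
    in-sumDiff (u , w) (u∈U , w∈rest) =
      let (w∈₁ , w∈₂ , w∈₃ , w∈₄) = InSystemWith-∩₄⁻ ns (four-fibres d r) _ _ _ _ w w∈rest
      in InSumDiff-u⊗ B' x₁+x₂≡x₃+x₄+u w
           (proj₂ (fibre-system x₁∈A) w w∈₁) (proj₂ (fibre-system x₂∈A) w w∈₂)
           (proj₂ (fibre-system x₃∈A) w w∈₃) (proj₂ (fibre-system x₄∈A) w w∈₄)
      where open In2A-2A (representation u u∈U)


module RationalBounds where

  open import Data.Integer using (_*_; _≤_; _<_)

  private
    -- + m / 1 does not normalise by computation when m is a variable
    ℕtoℚ≡mkℚ : ∀ m → ℕtoℚ m ≡ mkℚ (+ m) 0 (Coprime.sym (Coprime.1-coprimeTo m))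
    ℕtoℚ≡mkℚ m = ℚP.↥p/↧p≡p (mkℚ (+ m) 0 (Coprime.sym (Coprime.1-coprimeTo m)))

  0<↥ : ∀ δ → δ ℚ.> 0ℚ → 0ℤ < ↥ δ
  0<↥ δ (ℚ.*<* 0*↧δ<↥δ*1) = subst₂ _<_ (ℤP.*-zeroˡ (↧ δ)) (ℤP.*-identityʳ (↥ δ)) 0*↧δ<↥δ*1

  0<↧ : ∀ δ → 0ℤ < ↧ δ
  0<↧ (mkℚ _ _ _) = ℤ.+<+ (ℕ.s≤s ℕ.z≤n)

  δm≤n⇒↥δm≤↧δn : ∀ δ m n → δ ℚ.* ℕtoℚ m ℚ.≤ ℕtoℚ n → ↥ δ * + m ≤ ↧ δ * + n
  δm≤n⇒↥δm≤↧δn δ@(mkℚ _ _ _) m n δm≤n rewrite ℕtoℚ≡mkℚ m | ℕtoℚ≡mkℚ n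
    with ℚᵘP.≤-respˡ-≃ (ℚP.toℚᵘ-homo-* δ (mkℚ (+ m) 0 (Coprime.sym (Coprime.1-coprimeTo m)))) (ℚP.toℚᵘ-mono-≤ δm≤n)
  ... | ℚᵘ.*≤* le = subst₂ _≤_ (ℤP.*-identityʳ (↥ δ * + m))
                       (trans (cong (λ d → + n * + d) (ℕP.*-identityʳ (↧ₙ δ))) (ℤP.*-comm (+ n) (↧ δ))) le

  m↥δ²≤K↧δ²⇒mδ²≤K : ∀ δ m K → + m * (↥ δ * ↥ δ) ≤ + K * (↧ δ * ↧ δ) → ℕtoℚ m ℚ.* (δ ℚ.* δ) ℚ.≤ ℕtoℚ K
  m↥δ²≤K↧δ²⇒mδ²≤K δ@(mkℚ _ _ _) m K m↥δ²≤K↧δ² rewrite ℕtoℚ≡mkℚ m | ℕtoℚ≡mkℚ K =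
    ℚP.toℚᵘ-cancel-≤ (ℚᵘP.≤-respˡ-≃
      (ℚᵘP.≃-sym (ℚᵘP.≃-trans (ℚP.toℚᵘ-homo-* mℚ (δ ℚ.* δ)) (ℚᵘP.*-congˡ {toℚᵘ mℚ} (ℚP.toℚᵘ-homo-* δ δ))))
      (ℚᵘ.*≤* (subst₂ _≤_ (sym (ℤP.*-identityʳ (+ m * (↥ δ * ↥ δ))))
                          (cong (λ n → + K * + n) (sym (ℕP.*-identityˡ (↧ₙ δ ℕ.* ↧ₙ δ))))
                          m↥δ²≤K↧δ²)))
    where mℚ = mkℚ (+ m) 0 (Coprime.sym (Coprime.1-coprimeTo m))

  ≤f₁ : ∀ d δ (δ>0 : δ ℚ.> 0ℚ) m → + m * (↥ δ * ↥ δ) ≤ + (16 ^ d) * (↧ δ * ↧ δ) → ℕtoℚ m ℚ.≤ f₁ d δ δ>0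
  ≤f₁ d δ δ>0 m bound = begin
    ℕtoℚ m                          ≡⟨ sym (trans (ℚP.*-assoc (ℕtoℚ m) δ² (ℚ.1/ δ²))
                                         (trans (cong (ℕtoℚ m ℚ.*_) (ℚP.*-inverseʳ δ²)) (ℚP.*-identityʳ (ℕtoℚ m)))) ⟩
    ℕtoℚ m ℚ.* δ² ℚ.* ℚ.1/ δ²       ≤⟨ ℚP.*-monoʳ-≤-nonNeg (ℚ.1/ δ²) {{1/δ²-nonNeg}} (m↥δ²≤K↧δ²⇒mδ²≤K δ m (16 ^ d) bound) ⟩
    ℕtoℚ (16 ^ d) ℚ.* ℚ.1/ δ²       ∎
    where
    open ℚP.≤-Reasoning
    δ² = δ ℚ.* δ
    instance
      δ-pos : ℚ.Positive δ
      δ-pos = ℚ.positive δ>0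
      δ²-nonZero : ℚ.NonZero δ²
      δ²-nonZero = ℚP.pos⇒nonZero δ² {{ℚP.pos*pos⇒pos δ δ}}
    1/δ²-nonNeg : ℚ.NonNegative (ℚ.1/ δ²)
    1/δ²-nonNeg = ℚP.pos⇒nonNeg (ℚ.1/ δ²) {{ℚP.1/pos⇒pos δ² {{ℚP.pos*pos⇒pos δ δ}}}}

open RationalBounds

open import Data.Nat using (ℕ; _≤_)
open import Data.List using (List; length)
open import Data.List.Relation.Unary.All using (All)
open import Data.Rational as ℚ using (ℚ; 0ℚ)
open import Data.Product using (Σ)

lemma2p5 : (F : FiniteField) (ns : List ℕ) → 1 ≤ length ns → All (1 ≤_) ns →
    (δ : ℚ) (δ>0 : δ ℚ.> 0ℚ) (B' : SubMultiset F ns) →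
    δ ℚ.* ℕtoℚ (size𝓑 F ns) ℚ.≤ ℕtoℚ (size𝓑' F ns B') →
    Σ (System F (f₁ (length ns) δ δ>0) ns) λ S →
      ∀ us → InSystem F S us → InSumDiff F ns B' (f₂ (length ns)) (tensor F us)
lemma2p5 F ns _ ns≥1 δ δ>0 B' hyp =
  toSystem ≤f₁′ ns S , λ us us∈S → S⊆sumDiff us (InSystem-toSystem⁻ ≤f₁′ ns S us us∈S)
  where
  open Systems F using (toSystem; InSystem-toSystem⁻)
  open DenseInduction F using (Codim; bound; sumDiff-system)
  integral = sumDiff-system ns ns≥1 (0<↥ δ δ>0) (0<↧ δ) B' (δm≤n⇒↥δm≤↧δn δ _ _ hyp)
  S = proj₁ integral
  S⊆sumDiff = proj₂ integral
  ≤f₁′ : ∀ {m} → Codim (↥ δ) (↧ δ) (length ns) m → ℕtoℚ m ℚ.≤ f₁ (length ns) δ δ>0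
  ≤f₁′ {m} (bound m*δ²≤16^d) = ≤f₁ (length ns) δ δ>0 m m*δ²≤16^d
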